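{- For every $w\in\mathfrak{h}^1$ and every $i\ge1$, $\Psi(z_iw)=\xi_i\,\Psi(w)$ (concatenation product), where \[ \xi_i=\sum_{k=0}^{i-1}\binom{i-1}{k}(-\hbar)^{i-1-k}z_{k+1}\in\mathfrak{z}. \]
   Context: Let $\hbar$ be an indeterminate and $\mathcal{C}=\mathbb{Q}[\hbar]$. Let $\mathfrak{h}^1$ be the non-commutative polynomial algebra over $\mathcal{C}$ freely generated by letters $z_1,z_2,\dots$; juxtaposition is concatenation, words are monomials $z_{k_1}\cdots z_{k_r}$ ($r\ge0$, empty word $1$); $\mathfrak{z}$ is the $\mathcal{C}$-span of the letters. Products on letters: $z_i\circ z_j=z_{i+j}$, $z_i\circ_+z_j=z_{i+j}+\hbar z_{i+j-1}$; actions on $\mathfrak{h}^1$: $z_i\circ1=0$, $z_i\circ(z_jw)=(z_i\circ z_j)w$, and the same for $\circ_+$, extended $\mathcal{C}$-bilinearly. The $\mathcal{C}$-linear maps $d,d_q:\mathfrak{h}^1\to\mathfrak{h}^1$ are defined by $d(1)=d_q(1)=1$, $d(z_iw)=z_i\,d(w)+z_i\circ d(w)$, $d_q(z_iw)=z_i\,d_q(w)+z_i\circ_+d_q(w)$; $d_q$ is bijective. The $\mathcal{C}$-linear map $\phi$: for a word $u=z_{k_1}\cdots z_{k_r}$ of weight $K=\sum k_i$, let $I_u=\{k_1+\dots+k_j:1\le j<r\}$ and $\{1,\dots,K\}\setminus I_u=\{p_1<\dots<p_l\}$; then $\phi(u)=z_{p_1}z_{p_2-p_1}\cdots z_{p_l-p_{l-1}}$,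 $\phi(1)=1$. Define $\Psi=\phi\circ d_q^{ -1}\circ d\circ\phi:\mathfrak{h}^1\to\mathfrak{h}^1$ (composition of maps). -}

module Defs where

open import Data.Nat as ℕ using (ℕ; zero; suc; _∸_; pred)
open import Data.Nat.Combinatorics using (_C_)
open import Data.Integer using (+_)
open import Data.Rational as Q using (ℚ; 0ℚ; 1ℚ)
open import Data.List using (List; []; _∷_; _++_; map; concatMap; filter; upTo; replicate)
open import Data.Nat.ListAction using (sum)
open import Data.List.Properties using (≡-dec)
open import Data.List.Membership.DecPropositional ℕ._≟_ using (_∈?_)
open import Data.Product using (_×_; _,_)
open import Relation.Nullary using (¬?; yes; no)
open import Relation.Binary.PropositionalEquality using (_≡_)

-- Scalars  C = ℚ[ħ] : coefficient lists  c₀ ∷ c₁ ∷ …  (meaning Σ cₙ ħⁿ).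
-- Only the coefficient function `pcoeff` is used for equality, so trailing
-- zeros are irrelevant.

Poly : Set
Poly = List ℚ

pcoeff : Poly → ℕ → ℚ
pcoeff []       _       = 0ℚ
pcoeff (c ∷ _)  zero    = c
pcoeff (_ ∷ cs) (suc n) = pcoeff cs n

padd : Poly → Poly → Poly
padd []       q        = q
padd p        []       = p
padd (a ∷ p)  (b ∷ q)  = (a Q.+ b) ∷ padd p q

pscale : ℚ → Poly → Poly
pscale a = map (a Q.*_)

pmul : Poly → Poly → Poly
pmul []       q = []
pmul (a ∷ p)  q = padd (pscale a q) (0ℚ ∷ pmul p q)

pone : Poly
pone = 1ℚ ∷ []

ħ : Poly
ħ = 0ℚ ∷ 1ℚ ∷ []

-- Words.  ENCODING: the letter z_k (k ≥ 1) is represented by the natural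
-- number k ∸ 1, i.e. the entry  j : ℕ  stands for the letter  z_(suc j).

Word : Set
Word = List ℕ

idx : ℕ → ℕ
idx j = suc j

-- 𝔥¹ : finite formal C-linear combinations of words.

H : Set
H = List (Poly × Word)

coeff : H → Word → ℕ → ℚ
coeff []             u n = 0ℚ
coeff ((p , v) ∷ x)  u n with ≡-dec ℕ._≟_ v u
... | yes _ = pcoeff p n Q.+ coeff x u n
... | no  _ = coeff x u n

infix 4 _≈_
_≈_ : H → H → Set
x ≈ y = ∀ (u : Word) (n : ℕ) → coeff x u n ≡ coeff y u n

one : H
one = (pone , []) ∷ []

word : Word → H
word u = (pone , u) ∷ []

z : ℕ → H
z j = word (j ∷ [])

scale : Poly → H → H
scale c = map (λ { (p , u) → (pmul c p , u) })

lin : (Word → H) → H → H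
lin f = concatMap (λ { (p , u) → scale p (f u) })

infixl 7 _·_
_·_ : H → H → H
x · y = concatMap (λ { (p , u) → map (λ { (q , v) → (pmul p q , u ++ v) }) y }) x

-- Actions  z_i ∘ w  and  z_i ∘₊ w  (i encoded).
-- z_(a+1) ∘ z_(b+1) = z_(a+b+2)            : encoded  a + b + 1
-- z_(a+1) ∘₊ z_(b+1) = z_(a+b+2) + ħ z_(a+b+1) : encoded a+b+1 and a+b

circW : ℕ → Word → H
circW a []      = []
circW a (b ∷ w) = word (suc (a ℕ.+ b) ∷ w)

circ+W : ℕ → Word → H
circ+W a []      = []
circ+W a (b ∷ w) = (pone , suc (a ℕ.+ b) ∷ w) ∷ (ħ , (a ℕ.+ b) ∷ w) ∷ []

circ : ℕ → H → H
circ a = lin (circW a)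

circ+ : ℕ → H → H
circ+ a = lin (circ+W a)

dW : Word → H
dW []      = one
dW (a ∷ w) = z a · dW w ++ circ a (dW w)

dqW : Word → H
dqW []      = one
dqW (a ∷ w) = z a · dqW w ++ circ+ a (dqW w)

d : H → H
d = lin dW

dq : H → H
dq = lin dqW

-- The map φ.  For u = z_{k₁}⋯z_{k_r} of weight K:
--   I_u = {k₁+⋯+k_j : 1 ≤ j < r},  {1..K} ∖ I_u = {p₁<⋯<p_l},
--   φ(u) = z_{p₁} z_{p₂-p₁} ⋯ z_{p_l - p_{l-1}}.

weight : Word → ℕ
weight u = sum (map idx u)

psums : ℕ → Word → List ℕ
psums acc []            = []
psums acc (a ∷ [])      = []
psums acc (a ∷ b ∷ w)   = (acc ℕ.+ idx a) ∷ psums (acc ℕ.+ idx a) (b ∷ w)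

complementI : Word → List ℕ
complementI u = filter (λ p → ¬? (p ∈? psums 0 u)) (map suc (upTo (weight u)))

diffs : ℕ → List ℕ → List ℕ
diffs prev []       = []
diffs prev (p ∷ ps) = (p ∸ prev) ∷ diffs p ps

phiW : Word → Word
phiW u = map pred (diffs 0 (complementI u))   -- re-encode actual index k as k ∸ 1

φ : H → H
φ = lin (λ u → word (phiW u))

-- ξ_i for i = suc m :
--   ξ_i = Σ_{k=0}^{m} binom(m,k) (-ħ)^{m-k} z_{k+1}   (z_{k+1} encoded as k)

negOnePow : ℕ → ℚ
negOnePow zero    = 1ℚ
negOnePow (suc n) = Q.- negOnePow n

monomial : ℚ → ℕ → Poly
monomial c n = replicate n 0ℚ ++ (c ∷ [])

ξ : ℕ → H
ξ zero    = []
ξ (suc m) = map (λ k → (monomial (negOnePow (m ∸ k) Q.* ((+ (m C k)) Q./ 1)) (m ∸ k) , k ∷ []))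
                (upTo (suc m))

{-# OPTIONS --safe #-}
-- Write d_c for the map defined like d from z_i ∘_c z_j = z_{i+j} + c z_{i+j-1}, so that d = d_0 and
-- d_q = d_ħ, and put D_c = φ d_c φ. On words, φ(z_1 u) = raise φ(u) and φ(z_{k+1} u) = z_1 φ(z_k u), where
-- raise increases the first index by one (raise 1 = z_1). Hence D_c(z_1 u) = z_1 D_c(u) and
-- D_c(z_{k+1} u) = T_c D_c(z_k u) with T_c X = raise X + z_1 X + c X. Since T_c(X Y) = T_c(X) Y whenever X has
-- no constant term, D_c is multiplicative and D_c(z_{k+1}) = T_c^k z_1. Pascal's rule gives
-- ξ_{i+1} = raise ξ_i - ħ ξ_i, and T_ħ X - ħ X = T_0 X, so D_ħ(ξ_i) = T_0^{i-1} z_1 = D_0(z_i).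
-- If d_q v = d φ(z_i w) and d_q v' = d φ(w), i.e. Ψ(z_i w) = φ v and Ψ(w) = φ v', then D_ħ(φ v) = D_0(z_i w)
-- and D_ħ(φ v') = D_0(w), so D_ħ(φ v) = D_0(z_i) D_0(w) = D_ħ(ξ_i) D_ħ(φ v') = D_ħ(ξ_i φ v'). Finally D_ħ is
-- injective because d_q is: d_q w is w plus shorter words.
module Submission where

open import Defs
open import Algebra.Bundles using (CommutativeMonoid)
open import Data.Empty using (⊥-elim)
import Data.Integer as ℤ
import Data.Integer.Properties as ℤₚ
open import Data.List using (List; []; _∷_; _++_; map; filter; deduplicate; drop; length; upTo)
open import Data.List.Properties
  using ( ≡-dec; ∷-injectiveˡ; ++-assoc; ++-identityʳ; map-++; map-∘; map-cong; map-upTo; upTo-∷ʳ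
        ; concatMap-++; concatMap-cong; filter-accept; filter-reject )
open import Data.List.Membership.Propositional using (_∈_)
open import Data.List.Membership.Propositional.Properties using (∈-++⁺ˡ; ∈-++⁺ʳ; ∈-map⁺; ∈-map⁻)
open import Data.List.Relation.Unary.Any using (here; there)
import Data.Nat
open import Data.Nat as ℕ using (ℕ; zero; suc; _≤_; _<_; _∸_; s≤s)
open import Data.Nat.Combinatorics using (_C_; nCk+nC[k+1]≡[n+1]C[k+1]; nCn≡1; k>n⇒nCk≡0)
import Data.Nat.Coprimality as Coprime
open import Data.Nat.Coprimality using (1-coprimeTo)
import Data.Nat.Properties as ℕₚ
open import Data.Product using (_,_; proj₁; proj₂; ∃₂)
open import Data.Rational using (ℚ; mkℚ; 0ℚ; 1ℚ; _+_; _*_; -_; _/_)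
import Data.Rational.Properties as ℚₚ
open import Data.Rational.Solver using (module +-*-Solver)
open import Data.Sum using (_⊎_; inj₁; inj₂)
open import Function using (_∘_; _⇔_; mk⇔; Equivalence)
open import Level using (0ℓ)
open import Relation.Binary.Bundles using (Setoid)
open import Relation.Binary.Definitions using (tri<; tri≈; tri>)
open import Relation.Binary.PropositionalEquality
import Relation.Binary.Reasoning.Setoid as SetoidReasoning
open import Relation.Nullary using (Dec; yes; no; ¬_; ¬?)
open import Relation.Unary using (Pred; Decidable)

open import Data.List.Membership.DecPropositional ℕ._≟_ using (_∈?_)
open import Algebra.Properties.CommutativeSemigroup
  (CommutativeMonoid.commutativeSemigroup ℚₚ.+-0-commutativeMonoid)
  using () renaming (interchange to +-interchange)

-- Convolution of coefficient sequences

Seq : Set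
Seq = ℕ → ℚ

0ₛ : Seq
0ₛ _ = 0ℚ

infixl 6 _⊕_
_⊕_ : Seq → Seq → Seq
(f ⊕ g) n = f n + g n

infixl 7 _⋆_
_⋆_ : Seq → Seq → Seq
(f ⋆ g) zero    = f 0 * g 0
(f ⋆ g) (suc n) = f 0 * g (suc n) + ((f ∘ suc) ⋆ g) n

⋆-cong : ∀ {f f′ g g′} → f ≗ f′ → g ≗ g′ → f ⋆ g ≗ f′ ⋆ g′
⋆-cong f≗ g≗ zero    = cong₂ _*_ (f≗ 0) (g≗ 0)
⋆-cong f≗ g≗ (suc n) = cong₂ _+_ (cong₂ _*_ (f≗ 0) (g≗ (suc n))) (⋆-cong (f≗ ∘ suc) g≗ n)

⋆-zeroˡ : ∀ {f} g → f ≗ 0ₛ → f ⋆ g ≗ 0ₛ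
⋆-zeroˡ g f≗0 zero    = trans (cong (_* g 0) (f≗0 0)) (ℚₚ.*-zeroˡ (g 0))
⋆-zeroˡ g f≗0 (suc n) = trans (cong₂ _+_ (trans (cong (_* g (suc n)) (f≗0 0)) (ℚₚ.*-zeroˡ (g (suc n))))
                                         (⋆-zeroˡ g (f≗0 ∘ suc) n))
                              (ℚₚ.+-identityʳ 0ℚ)

⋆-zeroʳ : ∀ f {g} → g ≗ 0ₛ → f ⋆ g ≗ 0ₛ
⋆-zeroʳ f g≗0 zero    = trans (cong (f 0 *_) (g≗0 0)) (ℚₚ.*-zeroʳ (f 0))
⋆-zeroʳ f g≗0 (suc n) = trans (cong₂ _+_ (trans (cong (f 0 *_) (g≗0 (suc n))) (ℚₚ.*-zeroʳ (f 0)))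
                                         (⋆-zeroʳ (f ∘ suc) g≗0 n))
                              (ℚₚ.+-identityʳ 0ℚ)

⋆-distribˡ : ∀ f g h → f ⋆ (g ⊕ h) ≗ f ⋆ g ⊕ f ⋆ h
⋆-distribˡ f g h zero    = ℚₚ.*-distribˡ-+ (f 0) (g 0) (h 0)
⋆-distribˡ f g h (suc n) =
  trans (cong₂ _+_ (ℚₚ.*-distribˡ-+ (f 0) (g (suc n)) (h (suc n))) (⋆-distribˡ (f ∘ suc) g h n))
        (+-interchange (f 0 * g (suc n)) (f 0 * h (suc n)) ((f ∘ suc ⋆ g) n) ((f ∘ suc ⋆ h) n))

⋆-distribʳ : ∀ f g h → (f ⊕ g) ⋆ h ≗ f ⋆ h ⊕ g ⋆ h
⋆-distribʳ f g h zero    = ℚₚ.*-distribʳ-+ (h 0) (f 0) (g 0)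
⋆-distribʳ f g h (suc n) =
  trans (cong₂ _+_ (ℚₚ.*-distribʳ-+ (h (suc n)) (f 0) (g 0)) (⋆-distribʳ (f ∘ suc) (g ∘ suc) h n))
        (+-interchange (f 0 * h (suc n)) (g 0 * h (suc n)) ((f ∘ suc ⋆ h) n) ((g ∘ suc ⋆ h) n))

⋆-scaleˡ : ∀ a f g → (λ k → a * f k) ⋆ g ≗ λ k → a * (f ⋆ g) k
⋆-scaleˡ a f g zero    = ℚₚ.*-assoc a (f 0) (g 0)
⋆-scaleˡ a f g (suc n) =
  trans (cong₂ _+_ (ℚₚ.*-assoc a (f 0) (g (suc n))) (⋆-scaleˡ a (f ∘ suc) g n))
        (sym (ℚₚ.*-distribˡ-+ a (f 0 * g (suc n)) ((f ∘ suc ⋆ g) n)))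

⋆-sucʳ : ∀ f g n → (f ⋆ g) (suc n) ≡ (f ⋆ (g ∘ suc)) n + f (suc n) * g 0
⋆-sucʳ f g zero    = refl
⋆-sucʳ f g (suc n) = begin
  f 0 * g (suc (suc n)) + (f ∘ suc ⋆ g) (suc n)
    ≡⟨ cong (f 0 * g (suc (suc n)) +_) (⋆-sucʳ (f ∘ suc) g n) ⟩
  f 0 * g (suc (suc n)) + ((f ∘ suc ⋆ g ∘ suc) n + f (suc (suc n)) * g 0)
    ≡⟨ sym (ℚₚ.+-assoc (f 0 * g (suc (suc n))) ((f ∘ suc ⋆ g ∘ suc) n) (f (suc (suc n)) * g 0)) ⟩
  f 0 * g (suc (suc n)) + (f ∘ suc ⋆ g ∘ suc) n + f (suc (suc n)) * g 0 ∎
  where open ≡-Reasoning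

⋆-comm : ∀ f g → f ⋆ g ≗ g ⋆ f
⋆-comm f g zero    = ℚₚ.*-comm (f 0) (g 0)
⋆-comm f g (suc n) = begin
  f 0 * g (suc n) + (f ∘ suc ⋆ g) n   ≡⟨ cong (f 0 * g (suc n) +_) (⋆-comm (f ∘ suc) g n) ⟩
  f 0 * g (suc n) + (g ⋆ f ∘ suc) n   ≡⟨ ℚₚ.+-comm (f 0 * g (suc n)) ((g ⋆ f ∘ suc) n) ⟩
  (g ⋆ f ∘ suc) n + f 0 * g (suc n)   ≡⟨ cong ((g ⋆ f ∘ suc) n +_) (ℚₚ.*-comm (f 0) (g (suc n))) ⟩
  (g ⋆ f ∘ suc) n + g (suc n) * f 0   ≡⟨ sym (⋆-sucʳ g f n) ⟩
  (g ⋆ f) (suc n)                     ∎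
  where open ≡-Reasoning

⋆-assoc : ∀ f g h → (f ⋆ g) ⋆ h ≗ f ⋆ (g ⋆ h)
⋆-assoc f g h zero    = ℚₚ.*-assoc (f 0) (g 0) (h 0)
⋆-assoc f g h (suc n) = begin
  f 0 * g 0 * h (suc n) + (((λ k → f 0 * g (suc k)) ⊕ (f ∘ suc ⋆ g)) ⋆ h) n
    ≡⟨ cong (f 0 * g 0 * h (suc n) +_) (⋆-distribʳ (λ k → f 0 * g (suc k)) (f ∘ suc ⋆ g) h n) ⟩
  f 0 * g 0 * h (suc n) + (((λ k → f 0 * g (suc k)) ⋆ h) n + ((f ∘ suc ⋆ g) ⋆ h) n)
    ≡⟨ cong₂ (λ a b → f 0 * g 0 * h (suc n) + (a + b)) (⋆-scaleˡ (f 0) (g ∘ suc) h n) (⋆-assoc (f ∘ suc) g h n) ⟩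
  f 0 * g 0 * h (suc n) + (f 0 * (g ∘ suc ⋆ h) n + (f ∘ suc ⋆ (g ⋆ h)) n)
    ≡⟨ sym (ℚₚ.+-assoc (f 0 * g 0 * h (suc n)) (f 0 * (g ∘ suc ⋆ h) n) ((f ∘ suc ⋆ (g ⋆ h)) n)) ⟩
  f 0 * g 0 * h (suc n) + f 0 * (g ∘ suc ⋆ h) n + (f ∘ suc ⋆ (g ⋆ h)) n
    ≡⟨ cong (_+ (f ∘ suc ⋆ (g ⋆ h)) n)
         (trans (cong (_+ f 0 * (g ∘ suc ⋆ h) n) (ℚₚ.*-assoc (f 0) (g 0) (h (suc n))))
                (sym (ℚₚ.*-distribˡ-+ (f 0) (g 0 * h (suc n)) ((g ∘ suc ⋆ h) n)))) ⟩
  f 0 * (g ⋆ h) (suc n) + (f ∘ suc ⋆ (g ⋆ h)) n ∎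
  where open ≡-Reasoning

⋆-const : ∀ a g → pcoeff (a ∷ []) ⋆ g ≗ λ n → a * g n
⋆-const a g zero    = refl
⋆-const a g (suc n) = trans (cong (a * g (suc n) +_) (⋆-zeroˡ g (λ _ → refl) n)) (ℚₚ.+-identityʳ (a * g (suc n)))

⋆-identityˡ : ∀ g → pcoeff pone ⋆ g ≗ g
⋆-identityˡ g n = trans (⋆-const 1ℚ g n) (ℚₚ.*-identityˡ (g n))

⋆-identityʳ : ∀ f → f ⋆ pcoeff pone ≗ f
⋆-identityʳ f n = trans (⋆-comm f (pcoeff pone) n) (⋆-identityˡ f n)

ħ⋆-zero : ∀ g → (pcoeff ħ ⋆ g) 0 ≡ 0ℚ
ħ⋆-zero g = ℚₚ.*-zeroˡ (g 0)

ħ⋆-suc : ∀ g n → (pcoeff ħ ⋆ g) (suc n) ≡ g n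
ħ⋆-suc g n = trans (cong₂ _+_ (ℚₚ.*-zeroˡ (g (suc n))) (⋆-identityˡ g n)) (ℚₚ.+-identityˡ (g n))

-- Scalars in ℚ[ħ]

pcoeff-padd : ∀ p q → pcoeff (padd p q) ≗ pcoeff p ⊕ pcoeff q
pcoeff-padd []      q       n       = sym (ℚₚ.+-identityˡ (pcoeff q n))
pcoeff-padd (a ∷ p) []      n       = sym (ℚₚ.+-identityʳ (pcoeff (a ∷ p) n))
pcoeff-padd (a ∷ p) (b ∷ q) zero    = refl
pcoeff-padd (a ∷ p) (b ∷ q) (suc n) = pcoeff-padd p q n

pcoeff-pscale : ∀ a p n → pcoeff (pscale a p) n ≡ a * pcoeff p n
pcoeff-pscale a []      n       = sym (ℚₚ.*-zeroʳ a)
pcoeff-pscale a (b ∷ p) zero    = refl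
pcoeff-pscale a (b ∷ p) (suc n) = pcoeff-pscale a p n

pcoeff-pmul : ∀ p q → pcoeff (pmul p q) ≗ pcoeff p ⋆ pcoeff q
pcoeff-pmul []      q n       = sym (⋆-zeroˡ (pcoeff q) (λ _ → refl) n)
pcoeff-pmul (a ∷ p) q zero    =
  trans (pcoeff-padd (pscale a q) (0ℚ ∷ pmul p q) 0)
        (trans (ℚₚ.+-identityʳ (pcoeff (pscale a q) 0)) (pcoeff-pscale a q 0))
pcoeff-pmul (a ∷ p) q (suc n) =
  trans (pcoeff-padd (pscale a q) (0ℚ ∷ pmul p q) (suc n))
        (cong₂ _+_ (pcoeff-pscale a q (suc n)) (pcoeff-pmul p q n))

monomial-zero : ∀ e → pcoeff (monomial 0ℚ e) ≗ 0ₛ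
monomial-zero zero    zero    = refl
monomial-zero zero    (suc n) = refl
monomial-zero (suc e) zero    = refl
monomial-zero (suc e) (suc n) = monomial-zero e n

monomial-+ : ∀ c c′ e → pcoeff (monomial (c + c′) e) ≗ pcoeff (monomial c e) ⊕ pcoeff (monomial c′ e)
monomial-+ c c′ zero    zero    = refl
monomial-+ c c′ zero    (suc n) = sym (ℚₚ.+-identityʳ 0ℚ)
monomial-+ c c′ (suc e) zero    = sym (ℚₚ.+-identityʳ 0ℚ)
monomial-+ c c′ (suc e) (suc n) = monomial-+ c c′ e n

monomial-neg : ∀ c e n → pcoeff (monomial (- c) e) n ≡ - pcoeff (monomial c e) n
monomial-neg c zero    zero    = refl
monomial-neg c zero    (suc n) = refl
monomial-neg c (suc e) zero    = refl
monomial-neg c (suc e) (suc n) = monomial-neg c e n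

ħ⋆monomial : ∀ c e → pcoeff ħ ⋆ pcoeff (monomial c e) ≗ pcoeff (monomial c (suc e))
ħ⋆monomial c e zero    = ħ⋆-zero (pcoeff (monomial c e))
ħ⋆monomial c e (suc n) = ħ⋆-suc (pcoeff (monomial c e)) n

-- Coefficients in 𝔥¹

δ : Word → Word → ℚ → ℚ
δ v u a with ≡-dec ℕ._≟_ v u
... | yes _ = a
... | no  _ = 0ℚ

δ-refl : ∀ v a → δ v v a ≡ a
δ-refl v a with ≡-dec ℕ._≟_ v v
... | yes _  = refl
... | no v≢v = ⊥-elim (v≢v refl)

δ-≢ : ∀ {v u} a → v ≢ u → δ v u a ≡ 0ℚ
δ-≢ {v} {u} a v≢u with ≡-dec ℕ._≟_ v u
... | yes v≡u = ⊥-elim (v≢u v≡u)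
... | no  _   = refl

δ-resp : ∀ {v u v′ u′} a → (v ≡ u → v′ ≡ u′) → (v′ ≡ u′ → v ≡ u) → δ v u a ≡ δ v′ u′ a
δ-resp {v} {u} {v′} {u′} a to from with ≡-dec ℕ._≟_ v u | ≡-dec ℕ._≟_ v′ u′
... | yes _   | yes _    = refl
... | yes v≡u | no v′≢u′ = ⊥-elim (v′≢u′ (to v≡u))
... | no v≢u  | yes v′≡u′ = ⊥-elim (v≢u (from v′≡u′))
... | no _    | no _     = refl

δ-zero : ∀ v u → δ v u 0ℚ ≡ 0ℚ
δ-zero v u with ≡-dec ℕ._≟_ v u
... | yes _ = refl
... | no  _ = refl

δ-length : ∀ {v u} a → length v ≢ length u → δ v u a ≡ 0ℚ
δ-length {v} {u} a ne = δ-≢ {v} {u} a (ne ∘ cong length)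

δ-⋆ : ∀ v u f g n → (f ⋆ (λ k → δ v u (g k))) n ≡ δ v u ((f ⋆ g) n)
δ-⋆ v u f g n with ≡-dec ℕ._≟_ v u
... | yes _ = refl
... | no  _ = ⋆-zeroʳ f (λ _ → refl) n

⋆-δ : ∀ v u f g n → ((λ k → δ v u (f k)) ⋆ g) n ≡ δ v u ((f ⋆ g) n)
⋆-δ v u f g n with ≡-dec ℕ._≟_ v u
... | yes _ = refl
... | no  _ = ⋆-zeroˡ g (λ _ → refl) n

coeff-∷ : ∀ p v x u n → coeff ((p , v) ∷ x) u n ≡ δ v u (pcoeff p n) + coeff x u n
coeff-∷ p v x u n with ≡-dec ℕ._≟_ v u
... | yes _ = refl
... | no  _ = sym (ℚₚ.+-identityˡ (coeff x u n))

coeff-++ : ∀ x y u → coeff (x ++ y) u ≗ coeff x u ⊕ coeff y u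
coeff-++ []            y u n = sym (ℚₚ.+-identityˡ (coeff y u n))
coeff-++ ((p , v) ∷ x) y u n = begin
  coeff ((p , v) ∷ x ++ y) u n                       ≡⟨ coeff-∷ p v (x ++ y) u n ⟩
  δ v u (pcoeff p n) + coeff (x ++ y) u n            ≡⟨ cong (δ v u (pcoeff p n) +_) (coeff-++ x y u n) ⟩
  δ v u (pcoeff p n) + (coeff x u n + coeff y u n)   ≡⟨ sym (ℚₚ.+-assoc (δ v u (pcoeff p n)) (coeff x u n) (coeff y u n)) ⟩
  δ v u (pcoeff p n) + coeff x u n + coeff y u n     ≡⟨ cong (_+ coeff y u n) (sym (coeff-∷ p v x u n)) ⟩
  coeff ((p , v) ∷ x) u n + coeff y u n              ∎
  where open ≡-Reasoning

coeff-word : ∀ w u n → coeff (word w) u n ≡ δ w u (pcoeff pone n)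
coeff-word w u n = trans (coeff-∷ pone w [] u n) (ℚₚ.+-identityʳ (δ w u (pcoeff pone n)))

coeff-word-≢ : ∀ {v u} → v ≢ u → coeff (word v) u ≗ 0ₛ
coeff-word-≢ {v} {u} v≢u n = trans (coeff-word v u n) (δ-≢ {v} {u} (pcoeff pone n) v≢u)

⋆-coeff-word : ∀ p w u n → (pcoeff p ⋆ coeff (word w) u) n ≡ δ w u (pcoeff p n)
⋆-coeff-word p w u n = begin
  (pcoeff p ⋆ coeff (word w) u) n                  ≡⟨ ⋆-cong (λ _ → refl) (coeff-word w u) n ⟩
  (pcoeff p ⋆ (λ k → δ w u (pcoeff pone k))) n     ≡⟨ δ-⋆ w u (pcoeff p) (pcoeff pone) n ⟩
  δ w u ((pcoeff p ⋆ pcoeff pone) n)               ≡⟨ cong (δ w u) (⋆-identityʳ (pcoeff p) n) ⟩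
  δ w u (pcoeff p n)                               ∎
  where open ≡-Reasoning

coeff-word-∷ : ∀ a v u → coeff (word (a ∷ v)) (a ∷ u) ≗ coeff (word v) u
coeff-word-∷ a v u k = begin
  coeff (word (a ∷ v)) (a ∷ u) k    ≡⟨ coeff-word (a ∷ v) (a ∷ u) k ⟩
  δ (a ∷ v) (a ∷ u) (pcoeff pone k) ≡⟨ δ-resp {a ∷ v} {a ∷ u} {v} {u} (pcoeff pone k) (cong (drop 1)) (cong (a ∷_)) ⟩
  δ v u (pcoeff pone k)             ≡⟨ sym (coeff-word v u k) ⟩
  coeff (word v) u k                ∎
  where open ≡-Reasoning

linSeq : (Word → Seq) → H → Seq
linSeq g []            = 0ₛ
linSeq g ((p , v) ∷ x) = pcoeff p ⋆ g v ⊕ linSeq g x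

linSeq-++ : ∀ g x y → linSeq g (x ++ y) ≗ linSeq g x ⊕ linSeq g y
linSeq-++ g []            y n = sym (ℚₚ.+-identityˡ (linSeq g y n))
linSeq-++ g ((p , v) ∷ x) y n =
  trans (cong ((pcoeff p ⋆ g v) n +_) (linSeq-++ g x y n))
        (sym (ℚₚ.+-assoc ((pcoeff p ⋆ g v) n) (linSeq g x n) (linSeq g y n)))

linSeq-cong : ∀ {g g′} → (∀ v → g v ≗ g′ v) → ∀ x → linSeq g x ≗ linSeq g′ x
linSeq-cong g≗ []            n = refl
linSeq-cong g≗ ((p , v) ∷ x) n = cong₂ _+_ (⋆-cong (λ _ → refl) (g≗ v) n) (linSeq-cong g≗ x n)

linSeq-zero : ∀ {g} → (∀ v → g v ≗ 0ₛ) → ∀ x → linSeq g x ≗ 0ₛ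
linSeq-zero g≗0 []            n = refl
linSeq-zero g≗0 ((p , v) ∷ x) n =
  trans (cong₂ _+_ (⋆-zeroʳ (pcoeff p) (g≗0 v) n) (linSeq-zero g≗0 x n)) (ℚₚ.+-identityʳ 0ℚ)

linSeq-⊕ : ∀ g h x → linSeq (λ v → g v ⊕ h v) x ≗ linSeq g x ⊕ linSeq h x
linSeq-⊕ g h []            n = sym (ℚₚ.+-identityʳ 0ℚ)
linSeq-⊕ g h ((p , v) ∷ x) n =
  trans (cong₂ _+_ (⋆-distribˡ (pcoeff p) (g v) (h v) n) (linSeq-⊕ g h x n))
        (+-interchange ((pcoeff p ⋆ g v) n) ((pcoeff p ⋆ h v) n) (linSeq g x n) (linSeq h x n))

linSeq-⋆ : ∀ c g x → linSeq (λ v → c ⋆ g v) x ≗ c ⋆ linSeq g x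
linSeq-⋆ c g []            n = sym (⋆-zeroʳ c (λ _ → refl) n)
linSeq-⋆ c g ((p , v) ∷ x) n = begin
  (pcoeff p ⋆ (c ⋆ g v)) n + linSeq (λ v → c ⋆ g v) x n
    ≡⟨ cong₂ _+_ (sym (⋆-assoc (pcoeff p) c (g v) n)) (linSeq-⋆ c g x n) ⟩
  ((pcoeff p ⋆ c) ⋆ g v) n + (c ⋆ linSeq g x) n
    ≡⟨ cong (_+ (c ⋆ linSeq g x) n)
         (trans (⋆-cong (⋆-comm (pcoeff p) c) (λ _ → refl) n) (⋆-assoc c (pcoeff p) (g v) n)) ⟩
  (c ⋆ (pcoeff p ⋆ g v)) n + (c ⋆ linSeq g x) n
    ≡⟨ sym (⋆-distribˡ c (pcoeff p ⋆ g v) (linSeq g x) n) ⟩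
  (c ⋆ linSeq g ((p , v) ∷ x)) n ∎
  where open ≡-Reasoning

linSeq-swap : ∀ (G : Word → Word → Seq) x y →
              linSeq (λ v → linSeq (G v) y) x ≗ linSeq (λ v′ → linSeq (λ v → G v v′) x) y
linSeq-swap G []            y n = sym (linSeq-zero (λ _ _ → refl) y n)
linSeq-swap G ((p , v) ∷ x) y n = begin
  (pcoeff p ⋆ linSeq (G v) y) n + linSeq (λ v → linSeq (G v) y) x n
    ≡⟨ cong₂ _+_ (sym (linSeq-⋆ (pcoeff p) (G v) y n)) (linSeq-swap G x y n) ⟩
  linSeq (λ v′ → pcoeff p ⋆ G v v′) y n + linSeq (λ v′ → linSeq (λ v → G v v′) x) y n
    ≡⟨ sym (linSeq-⊕ (λ v′ → pcoeff p ⋆ G v v′) (λ v′ → linSeq (λ v → G v v′) x) y n) ⟩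
  linSeq (λ v′ → linSeq (λ v → G v v′) ((p , v) ∷ x)) y n ∎
  where open ≡-Reasoning

coeff-scale : ∀ c x u → coeff (scale c x) u ≗ pcoeff c ⋆ coeff x u
coeff-scale c []            u n = sym (⋆-zeroʳ (pcoeff c) (λ _ → refl) n)
coeff-scale c ((p , v) ∷ x) u n = begin
  coeff ((pmul c p , v) ∷ scale c x) u n
    ≡⟨ coeff-∷ (pmul c p) v (scale c x) u n ⟩
  δ v u (pcoeff (pmul c p) n) + coeff (scale c x) u n
    ≡⟨ cong₂ _+_ (trans (cong (δ v u) (pcoeff-pmul c p n)) (sym (δ-⋆ v u (pcoeff c) (pcoeff p) n)))
                 (coeff-scale c x u n) ⟩
  (pcoeff c ⋆ (λ k → δ v u (pcoeff p k))) n + (pcoeff c ⋆ coeff x u) n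
    ≡⟨ sym (⋆-distribˡ (pcoeff c) (λ k → δ v u (pcoeff p k)) (coeff x u) n) ⟩
  (pcoeff c ⋆ (λ k → δ v u (pcoeff p k) + coeff x u k)) n
    ≡⟨ ⋆-cong (λ _ → refl) (λ k → sym (coeff-∷ p v x u k)) n ⟩
  (pcoeff c ⋆ coeff ((p , v) ∷ x) u) n ∎
  where open ≡-Reasoning

coeff-lin : ∀ f x u → coeff (lin f x) u ≗ linSeq (λ v → coeff (f v) u) x
coeff-lin f []            u n = refl
coeff-lin f ((p , v) ∷ x) u n =
  trans (coeff-++ (scale p (f v)) (lin f x) u n)
        (cong₂ _+_ (coeff-scale p (f v) u n) (coeff-lin f x u n))

linSeq-scale : ∀ g c x → linSeq g (scale c x) ≗ pcoeff c ⋆ linSeq g x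
linSeq-scale g c []            n = sym (⋆-zeroʳ (pcoeff c) (λ _ → refl) n)
linSeq-scale g c ((p , v) ∷ x) n = begin
  (pcoeff (pmul c p) ⋆ g v) n + linSeq g (scale c x) n
    ≡⟨ cong₂ _+_ (trans (⋆-cong (pcoeff-pmul c p) (λ _ → refl) n) (⋆-assoc (pcoeff c) (pcoeff p) (g v) n))
                 (linSeq-scale g c x n) ⟩
  (pcoeff c ⋆ (pcoeff p ⋆ g v)) n + (pcoeff c ⋆ linSeq g x) n
    ≡⟨ sym (⋆-distribˡ (pcoeff c) (pcoeff p ⋆ g v) (linSeq g x) n) ⟩
  (pcoeff c ⋆ linSeq g ((p , v) ∷ x)) n ∎
  where open ≡-Reasoning

linSeq-lin : ∀ g f x → linSeq g (lin f x) ≗ linSeq (λ v → linSeq g (f v)) x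
linSeq-lin g f []            n = refl
linSeq-lin g f ((p , v) ∷ x) n =
  trans (linSeq-++ g (scale p (f v)) (lin f x) n)
        (cong₂ _+_ (linSeq-scale g p (f v) n) (linSeq-lin g f x n))

coeff-linSeq : ∀ x u → coeff x u ≗ linSeq (λ v → coeff (word v) u) x
coeff-linSeq []            u n = refl
coeff-linSeq ((p , v) ∷ x) u n =
  trans (coeff-∷ p v x u n) (cong₂ _+_ (sym (⋆-coeff-word p v u n)) (coeff-linSeq x u n))

sumOver : List Word → (Word → ℚ) → ℚ
sumOver []      F = 0ℚ
sumOver (w ∷ W) F = F w + sumOver W F

sumOver-cong : ∀ W {F G} → (∀ w → F w ≡ G w) → sumOver W F ≡ sumOver W G
sumOver-cong []      F≡G = refl
sumOver-cong (w ∷ W) F≡G = cong₂ _+_ (F≡G w) (sumOver-cong W F≡G)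

sumOver-+ : ∀ W (F G : Word → ℚ) → sumOver W (λ w → F w + G w) ≡ sumOver W F + sumOver W G
sumOver-+ []      F G = sym (ℚₚ.+-identityʳ 0ℚ)
sumOver-+ (w ∷ W) F G =
  trans (cong (F w + G w +_) (sumOver-+ W F G)) (+-interchange (F w) (G w) (sumOver W F) (sumOver W G))

sumOver-zero : ∀ W {F} → (∀ w → F w ≡ 0ℚ) → sumOver W F ≡ 0ℚ
sumOver-zero []      F≡0 = refl
sumOver-zero (w ∷ W) F≡0 = trans (cong₂ _+_ (F≡0 w) (sumOver-zero W F≡0)) (ℚₚ.+-identityʳ 0ℚ)

-- The filter applied by deduplicate, so that dedup (w ∷ W) unfolds to w ∷ without w (dedup W).
without : Word → List Word → List Word
without w = filter (¬? ∘ ≡-dec ℕ._≟_ w)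

dedup : List Word → List Word
dedup = deduplicate (≡-dec ℕ._≟_)

sumOver-without : ∀ w L (F : Word → ℚ) → F w ≡ 0ℚ → sumOver (without w L) F ≡ sumOver L F
sumOver-without w []       F Fw≡0 = refl
sumOver-without w (w′ ∷ L) F Fw≡0 with ≡-dec ℕ._≟_ w w′
... | yes refl = trans (sumOver-without w L F Fw≡0)
                       (trans (sym (ℚₚ.+-identityˡ (sumOver L F))) (cong (_+ sumOver L F) (sym Fw≡0)))
... | no  _    = cong (F w′ +_) (sumOver-without w L F Fw≡0)

sumOver-without-δ : ∀ v L (F : Word → ℚ) → sumOver (without v L) (λ w → δ v w (F w)) ≡ 0ℚ
sumOver-without-δ v []       F = refl
sumOver-without-δ v (w′ ∷ L) F with ≡-dec ℕ._≟_ v w′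
... | yes _   = sumOver-without-δ v L F
... | no v≢w′ = trans (cong₂ _+_ (δ-≢ (F w′) v≢w′) (sumOver-without-δ v L F)) (ℚₚ.+-identityʳ 0ℚ)

sumOver-dedup-δ : ∀ {v W} (F : Word → ℚ) → v ∈ W → sumOver (dedup W) (λ w → δ v w (F w)) ≡ F v
sumOver-dedup-δ {v} {w ∷ W} F v∈ with ≡-dec ℕ._≟_ v w
sumOver-dedup-δ {v} {w ∷ W} F v∈         | yes refl =
  trans (cong (F v +_) (sumOver-without-δ v (dedup W) F)) (ℚₚ.+-identityʳ (F v))
sumOver-dedup-δ {v} {w ∷ W} F (here v≡w) | no v≢w   = ⊥-elim (v≢w v≡w)
sumOver-dedup-δ {v} {w ∷ W} F (there v∈) | no v≢w   =
  trans (cong (0ℚ +_) (sumOver-without w (dedup W) (λ w′ → δ v w′ (F w′)) (δ-≢ (F w) v≢w)))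
        (trans (ℚₚ.+-identityˡ (sumOver (dedup W) (λ w′ → δ v w′ (F w′)))) (sumOver-dedup-δ F v∈))

support : H → List Word
support = map proj₂

linSeq-support : ∀ g x W → (∀ {v} → v ∈ support x → v ∈ W) →
                 ∀ n → linSeq g x n ≡ sumOver (dedup W) (λ w → (coeff x w ⋆ g w) n)
linSeq-support g []            W ⊆W n = sym (sumOver-zero (dedup W) (λ w → ⋆-zeroˡ (g w) (λ _ → refl) n))
linSeq-support g ((p , v) ∷ x) W ⊆W n = begin
  (pcoeff p ⋆ g v) n + linSeq g x n
    ≡⟨ cong₂ _+_ (sym (sumOver-dedup-δ (λ w → (pcoeff p ⋆ g w) n) (⊆W (here refl))))
                 (linSeq-support g x W (⊆W ∘ there) n) ⟩
  sumOver (dedup W) (λ w → δ v w ((pcoeff p ⋆ g w) n)) + sumOver (dedup W) (λ w → (coeff x w ⋆ g w) n)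
    ≡⟨ sym (sumOver-+ (dedup W) (λ w → δ v w ((pcoeff p ⋆ g w) n)) (λ w → (coeff x w ⋆ g w) n)) ⟩
  sumOver (dedup W) (λ w → δ v w ((pcoeff p ⋆ g w) n) + (coeff x w ⋆ g w) n)
    ≡⟨ sumOver-cong (dedup W) split ⟩
  sumOver (dedup W) (λ w → (coeff ((p , v) ∷ x) w ⋆ g w) n) ∎
  where
  open ≡-Reasoning
  split : ∀ w → δ v w ((pcoeff p ⋆ g w) n) + (coeff x w ⋆ g w) n ≡ (coeff ((p , v) ∷ x) w ⋆ g w) n
  split w = begin
    δ v w ((pcoeff p ⋆ g w) n) + (coeff x w ⋆ g w) n
      ≡⟨ cong (_+ (coeff x w ⋆ g w) n) (sym (⋆-δ v w (pcoeff p) (g w) n)) ⟩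
    ((λ k → δ v w (pcoeff p k)) ⋆ g w) n + (coeff x w ⋆ g w) n
      ≡⟨ sym (⋆-distribʳ (λ k → δ v w (pcoeff p k)) (coeff x w) (g w) n) ⟩
    ((λ k → δ v w (pcoeff p k) + coeff x w k) ⋆ g w) n
      ≡⟨ ⋆-cong (λ k → sym (coeff-∷ p v x w k)) (λ _ → refl) n ⟩
    (coeff ((p , v) ∷ x) w ⋆ g w) n ∎

linSeq-cong-support : ∀ {g g′} x → (∀ v → coeff x v ≗ 0ₛ ⊎ g v ≗ g′ v) → linSeq g x ≗ linSeq g′ x
linSeq-cong-support {g} {g′} x agree n =
  trans (linSeq-support g x (support x) (λ v∈ → v∈) n)
        (trans (sumOver-cong (dedup (support x)) term)
               (sym (linSeq-support g′ x (support x) (λ v∈ → v∈) n)))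
  where
  term : ∀ w → (coeff x w ⋆ g w) n ≡ (coeff x w ⋆ g′ w) n
  term w with agree w
  ... | inj₁ x≗0  = trans (⋆-zeroˡ (g w) x≗0 n) (sym (⋆-zeroˡ (g′ w) x≗0 n))
  ... | inj₂ g≗g′ = ⋆-cong (λ _ → refl) g≗g′ n

linSeq-resp-≈ : ∀ g {x y} → x ≈ y → linSeq g x ≗ linSeq g y
linSeq-resp-≈ g {x} {y} x≈y n = begin
  linSeq g x n
    ≡⟨ linSeq-support g x W ∈-++⁺ˡ n ⟩
  sumOver (dedup W) (λ w → (coeff x w ⋆ g w) n)
    ≡⟨ sumOver-cong (dedup W) (λ w → ⋆-cong (x≈y w) (λ _ → refl) n) ⟩
  sumOver (dedup W) (λ w → (coeff y w ⋆ g w) n)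
    ≡⟨ sym (linSeq-support g y W (∈-++⁺ʳ (support x)) n) ⟩
  linSeq g y n ∎
  where
  open ≡-Reasoning
  W = support x ++ support y

linSeq-null : ∀ {g} x → (∀ v → coeff x v ≗ 0ₛ ⊎ g v ≗ 0ₛ) → linSeq g x ≗ 0ₛ
linSeq-null x vanish n = trans (linSeq-cong-support x vanish n) (linSeq-zero (λ _ _ → refl) x n)

-- Linear maps on 𝔥¹

-- Defs' _≈_ as a record, so that x and y can be inferred from a proof of x ≋ y.
infix 4 _≋_
record _≋_ (x y : H) : Set where
  constructor mk≋
  field coeff-≡ : x ≈ y
open _≋_ public

≋-refl : ∀ {x} → x ≋ x
≋-refl = mk≋ λ u n → refl

≋-reflexive : ∀ {x y} → x ≡ y → x ≋ y
≋-reflexive refl = ≋-refl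

≋-sym : ∀ {x y} → x ≋ y → y ≋ x
≋-sym x≋y = mk≋ λ u n → sym (coeff-≡ x≋y u n)

≋-trans : ∀ {x y z} → x ≋ y → y ≋ z → x ≋ z
≋-trans x≋y y≋z = mk≋ λ u n → trans (coeff-≡ x≋y u n) (coeff-≡ y≋z u n)

≋-setoid : Setoid 0ℓ 0ℓ
≋-setoid = record
  { Carrier       = H
  ; _≈_           = _≋_
  ; isEquivalence = record { refl = ≋-refl ; sym = ≋-sym ; trans = ≋-trans }
  }

module ≋-Reasoning = SetoidReasoning ≋-setoid

++-cong : ∀ {x x′ y y′} → x ≋ x′ → y ≋ y′ → x ++ y ≋ x′ ++ y′
++-cong {x} {x′} {y} {y′} x≋x′ y≋y′ = mk≋ λ u n →
  trans (coeff-++ x y u n) (trans (cong₂ _+_ (coeff-≡ x≋x′ u n) (coeff-≡ y≋y′ u n)) (sym (coeff-++ x′ y′ u n)))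

scale-cong : ∀ {c c′ x y} → pcoeff c ≗ pcoeff c′ → x ≋ y → scale c x ≋ scale c′ y
scale-cong {c} {c′} {x} {y} c≗c′ x≋y = mk≋ λ u n →
  trans (coeff-scale c x u n) (trans (⋆-cong c≗c′ (coeff-≡ x≋y u) n) (sym (coeff-scale c′ y u n)))

scale-one : ∀ x → scale pone x ≋ x
scale-one x = mk≋ λ u n → trans (coeff-scale pone x u n) (⋆-identityˡ (coeff x u) n)

∷-null : ∀ {p} v x → pcoeff p ≗ 0ₛ → (p , v) ∷ x ≋ x
∷-null {p} v x p≗0 = mk≋ λ u n →
  trans (coeff-∷ p v x u n)
        (trans (cong (_+ coeff x u n) (trans (cong (δ v u) (p≗0 n)) (δ-zero v u))) (ℚₚ.+-identityˡ (coeff x u n)))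

scale-word : ∀ p w → scale p (word w) ≋ (p , w) ∷ []
scale-word p w = mk≋ λ u n →
  trans (coeff-∷ (pmul p pone) w [] u n)
        (trans (cong (λ c → δ w u c + 0ℚ) (trans (pcoeff-pmul p pone n) (⋆-identityʳ (pcoeff p) n)))
               (sym (coeff-∷ p w [] u n)))

scale-null : ∀ x → scale [] x ≋ []
scale-null x = mk≋ λ u n → trans (coeff-scale [] x u n) (⋆-zeroˡ (coeff x u) (λ _ → refl) n)

neg : H → H
neg = scale (- 1ℚ ∷ [])

coeff-neg : ∀ x u n → coeff (neg x) u n ≡ - coeff x u n
coeff-neg x u n = begin
  coeff (neg x) u n              ≡⟨ coeff-scale (- 1ℚ ∷ []) x u n ⟩
  (pcoeff (- 1ℚ ∷ []) ⋆ coeff x u) n ≡⟨ ⋆-const (- 1ℚ) (coeff x u) n ⟩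
  - 1ℚ * coeff x u n             ≡⟨ sym (ℚₚ.neg-distribˡ-* 1ℚ (coeff x u n)) ⟩
  - (1ℚ * coeff x u n)           ≡⟨ cong -_ (ℚₚ.*-identityˡ (coeff x u n)) ⟩
  - coeff x u n                  ∎
  where open ≡-Reasoning

++-neg : ∀ x → x ++ neg x ≋ []
++-neg x = mk≋ λ u n →
  trans (coeff-++ x (neg x) u n) (trans (cong (coeff x u n +_) (coeff-neg x u n)) (ℚₚ.+-inverseʳ (coeff x u n)))

≋-from-difference : ∀ x y → (∀ u → coeff (x ++ neg y) u ≗ 0ₛ) → x ≋ y
≋-from-difference x y x-y≗0 = mk≋ λ u n → begin
  coeff x u n                                      ≡⟨ sym (ℚₚ.+-identityʳ (coeff x u n)) ⟩
  coeff x u n + 0ℚ                                 ≡⟨ cong (coeff x u n +_) (sym (ℚₚ.+-inverseˡ (coeff y u n))) ⟩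
  coeff x u n + (- coeff y u n + coeff y u n)      ≡⟨ sym (ℚₚ.+-assoc (coeff x u n) (- coeff y u n) (coeff y u n)) ⟩
  coeff x u n + - coeff y u n + coeff y u n        ≡⟨ cong (_+ coeff y u n) (difference≡0 u n) ⟩
  0ℚ + coeff y u n                                 ≡⟨ ℚₚ.+-identityˡ (coeff y u n) ⟩
  coeff y u n                                      ∎
  where
  open ≡-Reasoning
  difference≡0 : ∀ u n → coeff x u n + - coeff y u n ≡ 0ℚ
  difference≡0 u n = trans (cong (coeff x u n +_) (sym (coeff-neg y u n)))
                       (trans (sym (coeff-++ x (neg y) u n)) (x-y≗0 u n))

lin-cong : ∀ {f g x y} → (∀ v → f v ≋ g v) → x ≋ y → lin f x ≋ lin g y
lin-cong {f} {g} {x} {y} f≋g x≋y = mk≋ λ u n → begin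
  coeff (lin f x) u n                      ≡⟨ coeff-lin f x u n ⟩
  linSeq (λ v → coeff (f v) u) x n         ≡⟨ linSeq-cong (λ v → coeff-≡ (f≋g v) u) x n ⟩
  linSeq (λ v → coeff (g v) u) x n         ≡⟨ linSeq-resp-≈ (λ v → coeff (g v) u) {x} {y} (coeff-≡ x≋y) n ⟩
  linSeq (λ v → coeff (g v) u) y n         ≡⟨ sym (coeff-lin g y u n) ⟩
  coeff (lin g y) u n                      ∎
  where open ≡-Reasoning

lin-congʳ : ∀ f {x y} → x ≋ y → lin f x ≋ lin f y
lin-congʳ f {x} {y} = lin-cong {f} {f} {x} {y} (λ v → ≋-refl)

lin-congˡ : ∀ {f g} → (∀ v → f v ≋ g v) → ∀ x → lin f x ≋ lin g x
lin-congˡ {f} {g} f≋g x = lin-cong {f} {g} {x} {x} f≋g ≋-refl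

lin-++ : ∀ f x y → lin f (x ++ y) ≡ lin f x ++ lin f y
lin-++ f = concatMap-++ _

lin-∘ : ∀ f g x → lin f (lin g x) ≋ lin (lin f ∘ g) x
lin-∘ f g x = mk≋ λ u n → begin
  coeff (lin f (lin g x)) u n                                ≡⟨ coeff-lin f (lin g x) u n ⟩
  linSeq (λ v → coeff (f v) u) (lin g x) n                   ≡⟨ linSeq-lin (λ v → coeff (f v) u) g x n ⟩
  linSeq (λ v → linSeq (λ w → coeff (f w) u) (g v)) x n      ≡⟨ linSeq-cong (λ v k → sym (coeff-lin f (g v) u k)) x n ⟩
  linSeq (λ v → coeff (lin f (g v)) u) x n                   ≡⟨ sym (coeff-lin (lin f ∘ g) x u n) ⟩
  coeff (lin (lin f ∘ g) x) u n                              ∎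
  where open ≡-Reasoning

lin-word : ∀ f w → lin f (word w) ≋ f w
lin-word f w = ≋-trans (≋-reflexive (++-identityʳ (scale pone (f w)))) (scale-one (f w))

lin-word-id : ∀ x → lin word x ≋ x
lin-word-id x = mk≋ λ u n → trans (coeff-lin word x u n) (sym (coeff-linSeq x u n))

lin-scale : ∀ f c x → lin f (scale c x) ≋ scale c (lin f x)
lin-scale f c x = mk≋ λ u n → begin
  coeff (lin f (scale c x)) u n                         ≡⟨ coeff-lin f (scale c x) u n ⟩
  linSeq (λ v → coeff (f v) u) (scale c x) n            ≡⟨ linSeq-scale (λ v → coeff (f v) u) c x n ⟩
  (pcoeff c ⋆ linSeq (λ v → coeff (f v) u) x) n         ≡⟨ ⋆-cong (λ _ → refl) (λ k → sym (coeff-lin f x u k)) n ⟩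
  (pcoeff c ⋆ coeff (lin f x) u) n                      ≡⟨ sym (coeff-scale c (lin f x) u n) ⟩
  coeff (scale c (lin f x)) u n                         ∎
  where open ≡-Reasoning

lin-++ᶠ : ∀ f g x → lin (λ v → f v ++ g v) x ≋ lin f x ++ lin g x
lin-++ᶠ f g x = mk≋ λ u n → begin
  coeff (lin (λ v → f v ++ g v) x) u n
    ≡⟨ coeff-lin _ x u n ⟩
  linSeq (λ v → coeff (f v ++ g v) u) x n
    ≡⟨ linSeq-cong (λ v → coeff-++ (f v) (g v) u) x n ⟩
  linSeq (λ v → coeff (f v) u ⊕ coeff (g v) u) x n
    ≡⟨ linSeq-⊕ _ _ x n ⟩
  linSeq (λ v → coeff (f v) u) x n + linSeq (λ v → coeff (g v) u) x n
    ≡⟨ cong₂ _+_ (sym (coeff-lin f x u n)) (sym (coeff-lin g x u n)) ⟩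
  coeff (lin f x) u n + coeff (lin g x) u n
    ≡⟨ sym (coeff-++ (lin f x) (lin g x) u n) ⟩
  coeff (lin f x ++ lin g x) u n ∎
  where open ≡-Reasoning

lin-scaleᶠ : ∀ c f x → lin (λ v → scale c (f v)) x ≋ scale c (lin f x)
lin-scaleᶠ c f x = mk≋ λ u n → begin
  coeff (lin (λ v → scale c (f v)) x) u n                 ≡⟨ coeff-lin _ x u n ⟩
  linSeq (λ v → coeff (scale c (f v)) u) x n              ≡⟨ linSeq-cong (λ v → coeff-scale c (f v) u) x n ⟩
  linSeq (λ v → pcoeff c ⋆ coeff (f v) u) x n             ≡⟨ linSeq-⋆ (pcoeff c) _ x n ⟩
  (pcoeff c ⋆ linSeq (λ v → coeff (f v) u) x) n           ≡⟨ ⋆-cong (λ _ → refl) (λ k → sym (coeff-lin f x u k)) n ⟩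
  (pcoeff c ⋆ coeff (lin f x) u) n                        ≡⟨ sym (coeff-scale c (lin f x) u n) ⟩
  coeff (scale c (lin f x)) u n                           ∎
  where open ≡-Reasoning

lin-swap : ∀ (F : Word → Word → H) x y → lin (λ v → lin (F v) y) x ≋ lin (λ v′ → lin (λ v → F v v′) x) y
lin-swap F x y = mk≋ λ u n → begin
  coeff (lin (λ v → lin (F v) y) x) u n
    ≡⟨ coeff-lin _ x u n ⟩
  linSeq (λ v → coeff (lin (F v) y) u) x n
    ≡⟨ linSeq-cong (λ v → coeff-lin (F v) y u) x n ⟩
  linSeq (λ v → linSeq (λ v′ → coeff (F v v′) u) y) x n
    ≡⟨ linSeq-swap (λ v v′ → coeff (F v v′) u) x y n ⟩
  linSeq (λ v′ → linSeq (λ v → coeff (F v v′) u) x) y n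
    ≡⟨ linSeq-cong (λ v′ k → sym (coeff-lin (λ v → F v v′) x u k)) y n ⟩
  linSeq (λ v′ → coeff (lin (λ v → F v v′) x) u) y n
    ≡⟨ sym (coeff-lin _ y u n) ⟩
  coeff (lin (λ v′ → lin (λ v → F v v′) x) y) u n ∎
  where open ≡-Reasoning

lin-≗ : ∀ {f g} → (∀ v → f v ≡ g v) → lin f ≗ lin g
lin-≗ f≡g = concatMap-cong (λ { (p , u) → cong (scale p) (f≡g u) })

ConstFree : H → Set
ConstFree x = coeff x [] ≗ 0ₛ

lin-agree : ∀ f g {x} → (∀ a u → f (a ∷ u) ≋ g (a ∷ u)) → ConstFree x → lin f x ≋ lin g x
lin-agree f g {x} f≋g x₀≗0 = mk≋ λ u n →
  trans (coeff-lin f x u n)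
        (trans (linSeq-cong-support x (agree u) n) (sym (coeff-lin g x u n)))
  where
  agree : ∀ u v → coeff x v ≗ 0ₛ ⊎ coeff (f v) u ≗ coeff (g v) u
  agree u []      = inj₁ x₀≗0
  agree u (a ∷ v) = inj₂ (coeff-≡ (f≋g a v) u)

ConstFree-∷ : ∀ p a v x → ConstFree x → ConstFree ((p , a ∷ v) ∷ x)
ConstFree-∷ p a v x x₀≗0 n =
  trans (coeff-∷ p (a ∷ v) x [] n)
        (trans (cong₂ _+_ (δ-≢ {a ∷ v} {[]} (pcoeff p n) (λ ())) (x₀≗0 n)) (ℚₚ.+-identityʳ 0ℚ))

ConstFree-word : ∀ a v → ConstFree (word (a ∷ v))
ConstFree-word a v = ConstFree-∷ pone a v [] (λ _ → refl)

ConstFree-++ : ∀ x y → ConstFree x → ConstFree y → ConstFree (x ++ y)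
ConstFree-++ x y x₀≗0 y₀≗0 n =
  trans (coeff-++ x y [] n) (trans (cong₂ _+_ (x₀≗0 n) (y₀≗0 n)) (ℚₚ.+-identityʳ 0ℚ))

ConstFree-scale : ∀ c x → ConstFree x → ConstFree (scale c x)
ConstFree-scale c x x₀≗0 n = trans (coeff-scale c x [] n) (⋆-zeroʳ (pcoeff c) x₀≗0 n)

ConstFree-lin : ∀ f x → (∀ v → ConstFree (f v)) → ConstFree (lin f x)
ConstFree-lin f x f₀≗0 n = trans (coeff-lin f x [] n) (linSeq-zero f₀≗0 x n)

-- Concatenation

coeff-·-single : ∀ p v y u → coeff (((p , v) ∷ []) · y) u ≗ pcoeff p ⋆ linSeq (λ v′ → coeff (word (v ++ v′)) u) y
coeff-·-single p v []            u n = sym (⋆-zeroʳ (pcoeff p) (λ _ → refl) n)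
coeff-·-single p v ((q , v′) ∷ y) u n = begin
  coeff ((pmul p q , v ++ v′) ∷ ((p , v) ∷ []) · y) u n
    ≡⟨ coeff-∷ (pmul p q) (v ++ v′) (((p , v) ∷ []) · y) u n ⟩
  δ (v ++ v′) u (pcoeff (pmul p q) n) + coeff (((p , v) ∷ []) · y) u n
    ≡⟨ cong₂ _+_ (trans (cong (δ (v ++ v′) u) (pcoeff-pmul p q n)) (sym (δ-⋆ (v ++ v′) u (pcoeff p) (pcoeff q) n)))
                 (coeff-·-single p v y u n) ⟩
  (pcoeff p ⋆ (λ k → δ (v ++ v′) u (pcoeff q k))) n + (pcoeff p ⋆ rest) n
    ≡⟨ sym (⋆-distribˡ (pcoeff p) (λ k → δ (v ++ v′) u (pcoeff q k)) rest n) ⟩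
  (pcoeff p ⋆ (λ k → δ (v ++ v′) u (pcoeff q k) + rest k)) n
    ≡⟨ ⋆-cong (λ _ → refl) (λ k → cong (_+ rest k) (sym (⋆-coeff-word q (v ++ v′) u k))) n ⟩
  (pcoeff p ⋆ linSeq (λ v′ → coeff (word (v ++ v′)) u) ((q , v′) ∷ y)) n ∎
  where
  open ≡-Reasoning
  rest = linSeq (λ v′ → coeff (word (v ++ v′)) u) y

coeff-· : ∀ x y u → coeff (x · y) u ≗ linSeq (λ v → linSeq (λ v′ → coeff (word (v ++ v′)) u) y) x
coeff-· []            y u n = refl
coeff-· ((p , v) ∷ x) y u n = begin
  coeff (((p , v) ∷ x) · y) u n
    -- both products unfold through the same mapped list M, as M ++ x · y and (M ++ []) ++ x · y
    ≡⟨ cong (λ t → coeff t u n) (sym (++-assoc (map (λ t → (pmul p (proj₁ t) , v ++ proj₂ t)) y) [] (x · y))) ⟩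
  coeff (((p , v) ∷ []) · y ++ x · y) u n
    ≡⟨ coeff-++ (((p , v) ∷ []) · y) (x · y) u n ⟩
  coeff (((p , v) ∷ []) · y) u n + coeff (x · y) u n
    ≡⟨ cong₂ _+_ (coeff-·-single p v y u n) (coeff-· x y u n) ⟩
  linSeq (λ v → linSeq (λ v′ → coeff (word (v ++ v′)) u) y) ((p , v) ∷ x) n ∎
  where open ≡-Reasoning

prepend : Word → H → H
prepend w = lin (λ v → word (w ++ v))

·-as-lin : ∀ x y → x · y ≋ lin (λ v → prepend v y) x
·-as-lin x y = mk≋ λ u n →
  trans (coeff-· x y u n)
        (trans (linSeq-cong (λ v → sym ∘ coeff-lin (λ v′ → word (v ++ v′)) y u) x n)
               (sym (coeff-lin (λ v → prepend v y) x u n)))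

·-cong : ∀ {x x′ y y′} → x ≋ x′ → y ≋ y′ → x · y ≋ x′ · y′
·-cong {x} {x′} {y} {y′} x≋x′ y≋y′ = begin
  x · y                          ≈⟨ ·-as-lin x y ⟩
  lin (λ v → prepend v y) x      ≈⟨ lin-cong (λ v → lin-congʳ (λ v′ → word (v ++ v′)) y≋y′) x≋x′ ⟩
  lin (λ v → prepend v y′) x′    ≈⟨ ≋-sym (·-as-lin x′ y′) ⟩
  x′ · y′                        ∎
  where open ≋-Reasoning

·-congˡ : ∀ {x x′} y → x ≋ x′ → x · y ≋ x′ · y
·-congˡ {x} {x′} y x≋x′ = ·-cong {x} {x′} {y} {y} x≋x′ ≋-refl

·-congʳ : ∀ x {y y′} → y ≋ y′ → x · y ≋ x · y′
·-congʳ x {y} {y′} = ·-cong {x} {x} {y} {y′} ≋-refl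

word-· : ∀ w y → word w · y ≋ prepend w y
word-· w y = ≋-trans (·-as-lin (word w) y) (lin-word (λ v → prepend v y) w)

word-word : ∀ w v → word w · word v ≋ word (w ++ v)
word-word w v = ≋-trans (word-· w (word v)) (lin-word (λ v′ → word (w ++ v′)) v)

·-linˡ : ∀ f x y → lin f x · y ≋ lin (λ v → f v · y) x
·-linˡ f x y = begin
  lin f x · y                               ≈⟨ ·-as-lin (lin f x) y ⟩
  lin (λ v → prepend v y) (lin f x)         ≈⟨ lin-∘ (λ v → prepend v y) f x ⟩
  lin (λ v → lin (λ w → prepend w y) (f v)) x ≈⟨ lin-congˡ (λ v → ≋-sym (·-as-lin (f v) y)) x ⟩
  lin (λ v → f v · y) x                     ∎
  where open ≋-Reasoning

·-linʳ : ∀ x g y → x · lin g y ≋ lin (λ v → x · g v) y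
·-linʳ x g y = begin
  x · lin g y                                        ≈⟨ ·-as-lin x (lin g y) ⟩
  lin (λ v → prepend v (lin g y)) x                  ≈⟨ lin-congˡ (λ v → lin-∘ (λ v′ → word (v ++ v′)) g y) x ⟩
  lin (λ v → lin (λ w → prepend v (g w)) y) x        ≈⟨ lin-swap (λ v w → prepend v (g w)) x y ⟩
  lin (λ w → lin (λ v → prepend v (g w)) x) y        ≈⟨ lin-congˡ (λ w → ≋-sym (·-as-lin x (g w))) y ⟩
  lin (λ v → x · g v) y                              ∎
  where open ≋-Reasoning

prepend-· : ∀ w y z → prepend w y · z ≋ lin (λ v → prepend (w ++ v) z) y
prepend-· w y z = ≋-trans (·-linˡ (λ v → word (w ++ v)) y z) (lin-congˡ (λ v → word-· (w ++ v) z) y)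

prepend-++ : ∀ w v z → prepend (w ++ v) z ≋ prepend w (prepend v z)
prepend-++ w v z = begin
  prepend (w ++ v) z
    ≈⟨ lin-congˡ (λ v′ → ≋-reflexive (cong word (++-assoc w v v′))) z ⟩
  lin (λ v′ → word (w ++ v ++ v′)) z
    ≈⟨ ≋-sym (lin-congˡ (λ v′ → lin-word (λ v″ → word (w ++ v″)) (v ++ v′)) z) ⟩
  lin (λ v′ → prepend w (word (v ++ v′))) z
    ≈⟨ ≋-sym (lin-∘ (λ v′ → word (w ++ v′)) (λ v′ → word (v ++ v′)) z) ⟩
  prepend w (prepend v z) ∎
  where open ≋-Reasoning

·-assoc : ∀ x y z → (x · y) · z ≋ x · (y · z)
·-assoc x y z = begin
  (x · y) · z
    ≈⟨ ·-congˡ z (·-as-lin x y) ⟩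
  lin (λ v → prepend v y) x · z
    ≈⟨ ·-linˡ (λ v → prepend v y) x z ⟩
  lin (λ v → prepend v y · z) x
    ≈⟨ lin-congˡ (λ v → prepend-· v y z) x ⟩
  lin (λ v → lin (λ v′ → prepend (v ++ v′) z) y) x
    ≈⟨ lin-congˡ (λ v → lin-congˡ (λ v′ → prepend-++ v v′ z) y) x ⟩
  lin (λ v → lin (λ v′ → prepend v (prepend v′ z)) y) x
    ≈⟨ lin-congˡ (λ v → ≋-sym (lin-∘ (λ v′ → word (v ++ v′)) (λ v′ → prepend v′ z) y)) x ⟩
  lin (λ v → prepend v (lin (λ v′ → prepend v′ z) y)) x
    ≈⟨ ≋-sym (·-as-lin x (lin (λ v′ → prepend v′ z) y)) ⟩
  x · lin (λ v′ → prepend v′ z) y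
    ≈⟨ ·-congʳ x (≋-sym (·-as-lin y z)) ⟩
  x · (y · z) ∎
  where open ≋-Reasoning

one-· : ∀ y → one · y ≋ y
one-· y = ≋-trans (word-· [] y) (lin-word-id y)

·-one : ∀ x → x · one ≋ x
·-one x = begin
  x · one                       ≈⟨ ·-as-lin x one ⟩
  lin (λ v → prepend v one) x   ≈⟨ lin-congˡ prepend-one x ⟩
  lin word x                    ≈⟨ lin-word-id x ⟩
  x                             ∎
  where
  open ≋-Reasoning
  prepend-one : ∀ v → prepend v one ≋ word v
  prepend-one v = ≋-trans (lin-word (λ v′ → word (v ++ v′)) []) (≋-reflexive (cong word (++-identityʳ v)))

·-++ˡ : ∀ x x′ y → (x ++ x′) · y ≡ x · y ++ x′ · y
·-++ˡ x x′ y = concatMap-++ _ x x′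

scale-· : ∀ c x y → scale c x · y ≋ scale c (x · y)
scale-· c x y = begin
  scale c x · y                              ≈⟨ ·-as-lin (scale c x) y ⟩
  lin (λ v → prepend v y) (scale c x)        ≈⟨ lin-scale (λ v → prepend v y) c x ⟩
  scale c (lin (λ v → prepend v y) x)        ≈⟨ scale-cong {c} {c} (λ _ → refl) (≋-sym (·-as-lin x y)) ⟩
  scale c (x · y)                            ∎
  where open ≋-Reasoning

coeff-z· : ∀ a y u → coeff (z a · y) u ≗ linSeq (λ v → coeff (word (a ∷ v)) u) y
coeff-z· a y u n =
  trans (coeff-· (z a) y u n)
        (trans (ℚₚ.+-identityʳ _) (⋆-identityˡ (linSeq (λ v → coeff (word (a ∷ v)) u) y) n))

coeff-z·-∷ : ∀ a y u → coeff (z a · y) (a ∷ u) ≗ coeff y u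
coeff-z·-∷ a y u n = begin
  coeff (z a · y) (a ∷ u) n                       ≡⟨ coeff-z· a y (a ∷ u) n ⟩
  linSeq (λ v → coeff (word (a ∷ v)) (a ∷ u)) y n ≡⟨ linSeq-cong (λ v → coeff-word-∷ a v u) y n ⟩
  linSeq (λ v → coeff (word v) u) y n             ≡⟨ sym (coeff-linSeq y u n) ⟩
  coeff y u n                                     ∎
  where open ≡-Reasoning

coeff-z·-≢ : ∀ {a b} y u → a ≢ b → coeff (z a · y) (b ∷ u) ≗ 0ₛ
coeff-z·-≢ {a} {b} y u a≢b n =
  trans (coeff-z· a y (b ∷ u) n)
        (linSeq-zero (λ v → coeff-word-≢ {a ∷ v} {b ∷ u} (a≢b ∘ ∷-injectiveˡ)) y n)

ConstFree-z· : ∀ a y → ConstFree (z a · y)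
ConstFree-z· a y n =
  trans (coeff-z· a y [] n) (linSeq-zero (λ v → coeff-word-≢ {a ∷ v} {[]} (λ ())) y n)

-- The maps d_c and their injectivity

circWith : Poly → ℕ → Word → H
circWith c a []      = []
circWith c a (b ∷ w) = (pone , suc (a ℕ.+ b) ∷ w) ∷ (c , (a ℕ.+ b) ∷ w) ∷ []

dWith : Poly → Word → H
dWith c []      = one
dWith c (a ∷ w) = z a · dWith c w ++ lin (circWith c a) (dWith c w)

dqW≡dWith : ∀ w → dqW w ≡ dWith ħ w
dqW≡dWith []      = refl
dqW≡dWith (a ∷ w) rewrite dqW≡dWith w = cong (z a · dWith ħ w ++_) (lin-≗ circ+W≡ (dWith ħ w))
  where
  circ+W≡ : ∀ v → circ+W a v ≡ circWith ħ a v
  circ+W≡ []      = refl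
  circ+W≡ (b ∷ v) = refl

dW≋dWith : ∀ w → dW w ≋ dWith [] w
dW≋dWith []      = ≋-refl
dW≋dWith (a ∷ w) = ++-cong (·-congʳ (z a) (dW≋dWith w)) (lin-cong circW≋ (dW≋dWith w))
  where
  circW≋ : ∀ v → circW a v ≋ circWith [] a v
  circW≋ []      = ≋-refl
  circW≋ (b ∷ v) = ≋-trans (≋-sym (≋-reflexive (++-identityʳ (word (suc (a ℕ.+ b) ∷ v)))))
                           (++-cong {word (suc (a ℕ.+ b) ∷ v)} ≋-refl (≋-sym (∷-null ((a ℕ.+ b) ∷ v) [] (λ _ → refl))))

ConstFree-dWith : ∀ c w → w ≢ [] → ConstFree (dWith c w)
ConstFree-dWith c []      w≢[] = ⊥-elim (w≢[] refl)
ConstFree-dWith c (a ∷ w) _    =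
  ConstFree-++ (z a · dWith c w) (lin (circWith c a) (dWith c w))
               (ConstFree-z· a (dWith c w)) (ConstFree-lin (circWith c a) (dWith c w) circ₀≗0)
  where
  circ₀≗0 : ∀ v → ConstFree (circWith c a v)
  circ₀≗0 []      n = refl
  circ₀≗0 (b ∷ v) = ConstFree-∷ pone (suc (a ℕ.+ b)) v ((c , (a ℕ.+ b) ∷ v) ∷ [])
                                (ConstFree-∷ c (a ℕ.+ b) v [] (λ _ → refl))

coeff-circWith : ∀ c a v u → length v ≢ length u → coeff (circWith c a v) u ≗ 0ₛ
coeff-circWith c a []      u ne n = refl
coeff-circWith c a (b ∷ v) u ne n = begin
  coeff ((pone , suc (a ℕ.+ b) ∷ v) ∷ (c , (a ℕ.+ b) ∷ v) ∷ []) u n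
    ≡⟨ coeff-∷ pone (suc (a ℕ.+ b) ∷ v) ((c , (a ℕ.+ b) ∷ v) ∷ []) u n ⟩
  δ (suc (a ℕ.+ b) ∷ v) u (pcoeff pone n) + coeff ((c , (a ℕ.+ b) ∷ v) ∷ []) u n
    ≡⟨ cong₂ _+_ (δ-length {suc (a ℕ.+ b) ∷ v} {u} (pcoeff pone n) ne)
                 (trans (coeff-∷ c ((a ℕ.+ b) ∷ v) [] u n)
                        (cong (_+ 0ℚ) (δ-length {(a ℕ.+ b) ∷ v} {u} (pcoeff c n) ne))) ⟩
  0ℚ + (0ℚ + 0ℚ) ∎
  where open ≡-Reasoning

dWith-triangular : ∀ c w u → length w ≤ length u → coeff (dWith c w) u ≗ coeff (word w) u
dWith-triangular c []      u w≤u n = refl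
dWith-triangular c (a ∷ w) u w<u n =
  trans (coeff-++ (z a · dWith c w) (lin (circWith c a) (dWith c w)) u n)
        (trans (cong₂ _+_ (leading u w<u) lower) (ℚₚ.+-identityʳ _))
  where
  leading : ∀ u → suc (length w) ≤ length u → coeff (z a · dWith c w) u n ≡ coeff (word (a ∷ w)) u n
  leading (b ∷ u′) (s≤s w≤u′) = by-head (a ℕ.≟ b)
    where
    by-head : Dec (a ≡ b) → coeff (z a · dWith c w) (b ∷ u′) n ≡ coeff (word (a ∷ w)) (b ∷ u′) n
    by-head (yes refl) = trans (coeff-z·-∷ a (dWith c w) u′ n)
                               (trans (dWith-triangular c w u′ w≤u′ n) (sym (coeff-word-∷ a w u′ n)))
    by-head (no a≢b)   = trans (coeff-z·-≢ (dWith c w) u′ a≢b n)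
                               (sym (coeff-word-≢ {a ∷ w} {b ∷ u′} (a≢b ∘ ∷-injectiveˡ) n))
  shorter : ∀ v → coeff (dWith c w) v ≗ 0ₛ ⊎ coeff (circWith c a v) u ≗ 0ₛ
  shorter v with length v ℕ.≟ length u
  ... | no  v≢u = inj₂ (coeff-circWith c a v u v≢u)
  ... | yes v≡u = inj₁ λ k →
    trans (dWith-triangular c w v (ℕₚ.≤-trans (ℕₚ.n≤1+n _) (subst (suc (length w) ≤_) (sym v≡u) w<u)) k)
          (coeff-word-≢ {w} {v} (λ w≡v → ℕₚ.<⇒≢ w<u (trans (cong length w≡v) v≡u)) k)
  lower : coeff (lin (circWith c a) (dWith c w)) u n ≡ 0ℚ
  lower = trans (coeff-lin (circWith c a) (dWith c w) u n) (linSeq-null (dWith c w) shorter n)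

maxLength : H → ℕ
maxLength []            = 0
maxLength ((p , v) ∷ x) = length v ℕ.⊔ maxLength x

coeff-beyond-maxLength : ∀ x u → maxLength x < length u → coeff x u ≗ 0ₛ
coeff-beyond-maxLength []            u x<u n = refl
coeff-beyond-maxLength ((p , v) ∷ x) u x<u n =
  trans (coeff-∷ p v x u n)
        (trans (cong₂ _+_ (δ-length {v} {u} (pcoeff p n) (ℕₚ.<⇒≢ v<u))
                          (coeff-beyond-maxLength x u x<u′ n))
               (ℚₚ.+-identityʳ 0ℚ))
  where
  v<u : length v < length u
  v<u = ℕₚ.≤-<-trans (ℕₚ.m≤m⊔n (length v) (maxLength x)) x<u
  x<u′ : maxLength x < length u
  x<u′ = ℕₚ.≤-<-trans (ℕₚ.m≤n⊔m (length v) (maxLength x)) x<u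

lin-dWith-leading : ∀ c x u → (∀ v → length u < length v → coeff x v ≗ 0ₛ) → coeff (lin (dWith c) x) u ≗ coeff x u
lin-dWith-leading c x u longer≗0 n = begin
  coeff (lin (dWith c) x) u n                  ≡⟨ coeff-lin (dWith c) x u n ⟩
  linSeq (λ v → coeff (dWith c v) u) x n       ≡⟨ linSeq-cong-support x agree n ⟩
  linSeq (λ v → coeff (word v) u) x n          ≡⟨ sym (coeff-linSeq x u n) ⟩
  coeff x u n                                  ∎
  where
  open ≡-Reasoning
  agree : ∀ v → coeff x v ≗ 0ₛ ⊎ coeff (dWith c v) u ≗ coeff (word v) u
  agree v with length v ℕ.≤? length u
  ... | yes v≤u = inj₂ (dWith-triangular c v u v≤u)
  ... | no  v≰u = inj₁ (longer≗0 v (ℕₚ.≰⇒> v≰u))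

lin-dWith-kernel : ∀ c x → lin (dWith c) x ≋ [] → ∀ u → coeff x u ≗ 0ₛ
lin-dWith-kernel c x dx≋0 u = below (suc (maxLength x)) u (ℕₚ.m≤n+m (suc (maxLength x)) (length u))
  where
  below : ∀ k u → maxLength x < length u ℕ.+ k → coeff x u ≗ 0ₛ
  below zero    u x<u = coeff-beyond-maxLength x u (subst (maxLength x <_) (ℕₚ.+-identityʳ (length u)) x<u)
  below (suc k) u x<u n =
    trans (sym (lin-dWith-leading c x u longer≗0 n)) (coeff-≡ dx≋0 u n)
    where
    longer≗0 : ∀ v → length u < length v → coeff x v ≗ 0ₛ
    longer≗0 v u<v = below k v (ℕₚ.<-≤-trans x<u (subst (_≤ length v ℕ.+ k) (sym (ℕₚ.+-suc (length u) k))
                                                        (ℕₚ.+-monoˡ-≤ k u<v)))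

lin-dWith-injective : ∀ c {x y} → lin (dWith c) x ≋ lin (dWith c) y → x ≋ y
lin-dWith-injective c {x} {y} dx≋dy = ≋-from-difference x y (lin-dWith-kernel c (x ++ neg y) d[x-y]≋0)
  where
  open ≋-Reasoning
  d[x-y]≋0 : lin (dWith c) (x ++ neg y) ≋ []
  d[x-y]≋0 = begin
    lin (dWith c) (x ++ neg y)                   ≡⟨ lin-++ (dWith c) x (neg y) ⟩
    lin (dWith c) x ++ lin (dWith c) (neg y)     ≈⟨ ++-cong dx≋dy (lin-scale (dWith c) (- 1ℚ ∷ []) y) ⟩
    lin (dWith c) y ++ neg (lin (dWith c) y)     ≈⟨ ++-neg (lin (dWith c) y) ⟩
    []                                           ∎

dq-injective : ∀ {x y} → dq x ≋ dq y → x ≋ y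
dq-injective {x} {y} dqx≋dqy = lin-dWith-injective ħ
  (≋-trans (≋-sym (≋-reflexive (lin-≗ dqW≡dWith x))) (≋-trans dqx≋dqy (≋-reflexive (lin-≗ dqW≡dWith y))))

-- The involution φ

raiseW : Word → Word
raiseW []      = 0 ∷ []
raiseW (b ∷ r) = suc b ∷ r

mutual
  φ′ : Word → Word
  φ′ []      = []
  φ′ (a ∷ u) = φ′-∷ a u

  φ′-∷ : ℕ → Word → Word
  φ′-∷ zero    u = raiseW (φ′ u)
  φ′-∷ (suc a) u = 0 ∷ φ′-∷ a u

filter-map : ∀ {A B : Set} {P : Pred B 0ℓ} {Q : Pred A 0ℓ} (P? : Decidable P) (Q? : Decidable Q) (f : A → B) xs →
             (∀ {x} → x ∈ xs → P (f x) ⇔ Q x) → filter P? (map f xs) ≡ map f (filter Q? xs)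
filter-map P? Q? f []       P⇔Q = refl
filter-map P? Q? f (x ∷ xs) P⇔Q with Q? x
... | yes qx = trans (filter-accept P? (Equivalence.from (P⇔Q (here refl)) qx))
                     (cong (f x ∷_) (filter-map P? Q? f xs (P⇔Q ∘ there)))
... | no ¬qx = trans (filter-reject P? (¬qx ∘ Equivalence.to (P⇔Q (here refl))))
                     (filter-map P? Q? f xs (P⇔Q ∘ there))

upTo-suc : ∀ n → upTo (suc n) ≡ 0 ∷ map suc (upTo n)
upTo-suc n = cong (0 ∷_) (sym (map-upTo suc n))

suc∈map-suc : ∀ {x xs} → suc x ∈ map suc xs ⇔ x ∈ xs
suc∈map-suc = mk⇔ (λ sx∈ → let (y , y∈ , sx≡sy) = ∈-map⁻ suc sx∈ in subst (_∈ _) (sym (ℕₚ.suc-injective sx≡sy)) y∈)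
                  (∈-map⁺ suc)

¬-⇔ : ∀ {A B : Set} → A ⇔ B → (¬ A) ⇔ (¬ B)
¬-⇔ A⇔B = mk⇔ (_∘ Equivalence.from A⇔B) (_∘ Equivalence.to A⇔B)

psums-+ : ∀ acc u → psums acc u ≡ map (acc ℕ.+_) (psums 0 u)
psums-+ acc []          = refl
psums-+ acc (a ∷ [])    = refl
psums-+ acc (a ∷ b ∷ w) = cong (acc ℕ.+ suc a ∷_) (begin
  psums (acc ℕ.+ suc a) (b ∷ w)                          ≡⟨ psums-+ (acc ℕ.+ suc a) (b ∷ w) ⟩
  map (acc ℕ.+ suc a ℕ.+_) (psums 0 (b ∷ w))             ≡⟨ map-cong (ℕₚ.+-assoc acc (suc a)) (psums 0 (b ∷ w)) ⟩
  map ((acc ℕ.+_) ∘ (suc a ℕ.+_)) (psums 0 (b ∷ w))      ≡⟨ map-∘ (psums 0 (b ∷ w)) ⟩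
  map (acc ℕ.+_) (map (suc a ℕ.+_) (psums 0 (b ∷ w)))    ≡⟨ cong (map (acc ℕ.+_)) (sym (psums-+ (suc a) (b ∷ w))) ⟩
  map (acc ℕ.+_) (psums (suc a) (b ∷ w))                 ∎)
  where open ≡-Reasoning

psums-suc : ∀ a u → psums 0 (suc a ∷ u) ≡ map suc (psums 0 (a ∷ u))
psums-suc a []      = refl
psums-suc a (b ∷ w) = cong (suc (suc a) ∷_) (begin
  psums (suc (suc a)) (b ∷ w)                   ≡⟨ psums-+ (suc (suc a)) (b ∷ w) ⟩
  map (suc ∘ (suc a ℕ.+_)) (psums 0 (b ∷ w))    ≡⟨ map-∘ (psums 0 (b ∷ w)) ⟩
  map suc (map (suc a ℕ.+_) (psums 0 (b ∷ w)))  ≡⟨ cong (map suc) (sym (psums-+ (suc a) (b ∷ w))) ⟩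
  map suc (psums (suc a) (b ∷ w))               ∎)
  where open ≡-Reasoning

psums-zero : ∀ b w → psums 0 (0 ∷ b ∷ w) ≡ 1 ∷ map suc (psums 0 (b ∷ w))
psums-zero b w = cong (1 ∷_) (psums-+ 1 (b ∷ w))

psums-> : ∀ acc u {x} → x ∈ psums acc u → acc < x
psums-> acc (a ∷ b ∷ w) (here refl) = ℕₚ.m<m+n acc ℕₚ.0<1+n
psums-> acc (a ∷ b ∷ w) (there x∈)  = ℕₚ.<-trans (ℕₚ.m<m+n acc ℕₚ.0<1+n) (psums-> (acc ℕ.+ suc a) (b ∷ w) x∈)

∉? : (S : List ℕ) → Decidable (λ p → ¬ p ∈ S)
∉? S p = ¬? (p ∈? S)

complementI-suc : ∀ a u → complementI (suc a ∷ u) ≡ 1 ∷ map suc (complementI (a ∷ u))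
complementI-suc a u = begin
  filter (∉? (psums 0 (suc a ∷ u))) (map suc (upTo (suc K)))
    ≡⟨ cong₂ (λ S L → filter (∉? S) (map suc L)) (psums-suc a u) (upTo-suc K) ⟩
  filter (∉? (map suc P)) (1 ∷ map suc (map suc (upTo K)))
    ≡⟨ filter-accept (∉? (map suc P)) {xs = map suc (map suc (upTo K))} 1∉ ⟩
  1 ∷ filter (∉? (map suc P)) (map suc (map suc (upTo K)))
    ≡⟨ cong (1 ∷_) (filter-map (∉? (map suc P)) (∉? P) suc (map suc (upTo K)) (λ _ → ¬-⇔ suc∈map-suc)) ⟩
  1 ∷ map suc (filter (∉? P) (map suc (upTo K)))  ∎
  where
  open ≡-Reasoning
  K = weight (a ∷ u)
  P = psums 0 (a ∷ u)
  1∉ : ¬ 1 ∈ map suc P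
  1∉ 1∈ = ℕₚ.<-irrefl refl (psums-> 0 (a ∷ u) (Equivalence.to suc∈map-suc 1∈))

complementI-zero : ∀ b w → complementI (0 ∷ b ∷ w) ≡ map suc (complementI (b ∷ w))
complementI-zero b w = begin
  filter (∉? (psums 0 (0 ∷ b ∷ w))) (map suc (upTo (suc K)))
    ≡⟨ cong₂ (λ S L → filter (∉? S) (map suc L)) (psums-zero b w) (upTo-suc K) ⟩
  filter (∉? (1 ∷ map suc P)) (1 ∷ map suc (map suc (upTo K)))
    ≡⟨ filter-reject (∉? (1 ∷ map suc P)) {xs = map suc (map suc (upTo K))} (λ 1∉ → 1∉ (here refl)) ⟩
  filter (∉? (1 ∷ map suc P)) (map suc (map suc (upTo K)))
    ≡⟨ filter-map (∉? (1 ∷ map suc P)) (∉? P) suc (map suc (upTo K)) (¬-⇔ ∘ positive) ⟩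
  map suc (filter (∉? P) (map suc (upTo K)))  ∎
  where
  open ≡-Reasoning
  K = weight (b ∷ w)
  P = psums 0 (b ∷ w)
  positive : ∀ {x} → x ∈ map suc (upTo K) → suc x ∈ (1 ∷ map suc P) ⇔ x ∈ P
  positive x∈ with ∈-map⁻ suc x∈
  ... | (y , _ , refl) = mk⇔ (λ { (here ()) ; (there sx∈) → Equivalence.to suc∈map-suc sx∈ })
                             (there ∘ Equivalence.from suc∈map-suc)

complementI-head : ∀ b w → ∃₂ λ c C → complementI (b ∷ w) ≡ suc c ∷ C
complementI-head (suc a) w       = 0 , map suc (complementI (a ∷ w)) , complementI-suc a w
complementI-head zero    []      = 0 , [] , refl
complementI-head zero    (b ∷ w) with complementI-head b w
... | (c , C , eq) = suc c , map suc C , trans (complementI-zero b w) (cong (map suc) eq)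

diffs-suc : ∀ p C → diffs (suc p) (map suc C) ≡ diffs p C
diffs-suc p []      = refl
diffs-suc p (c ∷ C) = cong (c ∸ p ∷_) (diffs-suc c C)

phiW-suc : ∀ a u → phiW (suc a ∷ u) ≡ 0 ∷ phiW (a ∷ u)
phiW-suc a u = trans (cong (map ℕ.pred ∘ diffs 0) (complementI-suc a u))
                     (cong ((0 ∷_) ∘ map ℕ.pred) (diffs-suc 0 (complementI (a ∷ u))))

phiW-zero : ∀ b w → phiW (0 ∷ b ∷ w) ≡ raiseW (phiW (b ∷ w))
phiW-zero b w with complementI-head b w
... | (c , C , eq) = begin
  map ℕ.pred (diffs 0 (complementI (0 ∷ b ∷ w)))
    ≡⟨ cong (map ℕ.pred ∘ diffs 0) (trans (complementI-zero b w) (cong (map suc) eq)) ⟩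
  suc c ∷ map ℕ.pred (diffs (suc (suc c)) (map suc C))
    ≡⟨ cong ((suc c ∷_) ∘ map ℕ.pred) (diffs-suc (suc c) C) ⟩
  raiseW (map ℕ.pred (diffs 0 (suc c ∷ C)))
    ≡⟨ cong (raiseW ∘ map ℕ.pred ∘ diffs 0) (sym eq) ⟩
  raiseW (phiW (b ∷ w)) ∎
  where open ≡-Reasoning

mutual
  phiW≡φ′ : ∀ u → phiW u ≡ φ′ u
  phiW≡φ′ []      = refl
  phiW≡φ′ (a ∷ u) = phiW≡φ′-∷ a u

  phiW≡φ′-∷ : ∀ a u → phiW (a ∷ u) ≡ φ′-∷ a u
  phiW≡φ′-∷ (suc a) u       = trans (phiW-suc a u) (cong (0 ∷_) (phiW≡φ′-∷ a u))
  phiW≡φ′-∷ zero    []      = refl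
  phiW≡φ′-∷ zero    (b ∷ w) = trans (phiW-zero b w) (cong raiseW (phiW≡φ′-∷ b w))

φ′-raiseW : ∀ r → φ′ (raiseW r) ≡ 0 ∷ φ′ r
φ′-raiseW []      = refl
φ′-raiseW (b ∷ r) = refl

mutual
  φ′-involutive : ∀ u → φ′ (φ′ u) ≡ u
  φ′-involutive []      = refl
  φ′-involutive (a ∷ u) = φ′-∷-involutive a u

  φ′-∷-involutive : ∀ a u → φ′ (φ′-∷ a u) ≡ a ∷ u
  φ′-∷-involutive zero    u = trans (φ′-raiseW (φ′ u)) (cong (0 ∷_) (φ′-involutive u))
  φ′-∷-involutive (suc a) u = cong raiseW (φ′-∷-involutive a u)

φ′-∷-≢[] : ∀ a u → φ′-∷ a u ≢ []
φ′-∷-≢[] zero    u with φ′ u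
... | []    = λ ()
... | _ ∷ _ = λ ()
φ′-∷-≢[] (suc a) u = λ ()

φ-word : ∀ u → φ (word u) ≋ word (φ′ u)
φ-word u = ≋-trans (lin-word (λ v → word (phiW v)) u) (≋-reflexive (cong word (phiW≡φ′ u)))

φ-cong : ∀ {x y} → x ≋ y → φ x ≋ φ y
φ-cong = lin-congʳ (λ v → word (phiW v))

φ-involutive : ∀ x → φ (φ x) ≋ x
φ-involutive x = begin
  φ (φ x)                          ≈⟨ lin-∘ (λ v → word (phiW v)) (λ v → word (phiW v)) x ⟩
  lin (λ v → φ (word (phiW v))) x  ≈⟨ lin-congˡ φφ-word x ⟩
  lin word x                       ≈⟨ lin-word-id x ⟩
  x                                ∎
  where
  open ≋-Reasoning
  φφ-word : ∀ v → φ (word (phiW v)) ≋ word v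
  φφ-word v = ≋-trans (φ-word (phiW v)) (≋-reflexive (cong word (trans (cong φ′ (phiW≡φ′ v)) (φ′-involutive v))))

φ-cancel : ∀ {x y} → φ x ≋ φ y → x ≋ y
φ-cancel {x} {y} φx≋φy =
  ≋-trans (≋-sym (φ-involutive x)) (≋-trans (lin-congʳ (λ v → word (phiW v)) φx≋φy) (φ-involutive y))

-- The conjugates φ d_c φ

raise : H → H
raise = lin (word ∘ raiseW)

ConstFree-raise : ∀ x → ConstFree (raise x)
ConstFree-raise x = ConstFree-lin (word ∘ raiseW) x λ { [] → ConstFree-word 0 [] ; (b ∷ r) → ConstFree-word (suc b) r }

φ-raise : ∀ x → φ (raise x) ≋ z 0 · φ x
φ-raise x = begin
  φ (raise x)                                 ≈⟨ lin-∘ (λ v → word (phiW v)) (word ∘ raiseW) x ⟩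
  lin (λ v → φ (word (raiseW v))) x           ≈⟨ lin-congˡ φ-raise-word x ⟩
  lin (λ v → z 0 · word (phiW v)) x           ≈⟨ ≋-sym (·-linʳ (z 0) (λ v → word (phiW v)) x) ⟩
  z 0 · φ x                                   ∎
  where
  open ≋-Reasoning
  φ-raise-word : ∀ v → φ (word (raiseW v)) ≋ z 0 · word (phiW v)
  φ-raise-word v = begin
    φ (word (raiseW v))       ≈⟨ φ-word (raiseW v) ⟩
    word (φ′ (raiseW v))      ≡⟨ cong word (trans (φ′-raiseW v) (cong (0 ∷_) (sym (phiW≡φ′ v)))) ⟩
    word (0 ∷ phiW v)         ≈⟨ ≋-sym (word-word (0 ∷ []) (phiW v)) ⟩
    z 0 · word (phiW v)       ∎

φ-z0· : ∀ x → φ (z 0 · x) ≋ raise (φ x)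
φ-z0· x = begin
  φ (z 0 · x)            ≈⟨ lin-congʳ (λ v → word (phiW v)) (·-congʳ (z 0) (≋-sym (φ-involutive x))) ⟩
  φ (z 0 · φ (φ x))      ≈⟨ lin-congʳ (λ v → word (phiW v)) (≋-sym (φ-raise (φ x))) ⟩
  φ (φ (raise (φ x)))    ≈⟨ φ-involutive (raise (φ x)) ⟩
  raise (φ x)            ∎
  where open ≋-Reasoning

raise-z· : ∀ a y → raise (z a · y) ≋ z (suc a) · y
raise-z· a y = begin
  raise (z a · y)                           ≈⟨ lin-congʳ (word ∘ raiseW) (word-· (a ∷ []) y) ⟩
  raise (prepend (a ∷ []) y)                ≈⟨ lin-∘ (word ∘ raiseW) (λ v → word (a ∷ v)) y ⟩
  lin (λ v → raise (word (a ∷ v))) y        ≈⟨ lin-congˡ (λ v → lin-word (word ∘ raiseW) (a ∷ v)) y ⟩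
  prepend (suc a ∷ []) y                    ≈⟨ ≋-sym (word-· (suc a ∷ []) y) ⟩
  z (suc a) · y                             ∎
  where open ≋-Reasoning

raise-circWith : ∀ c a x → raise (lin (circWith c a) x) ≋ lin (circWith c (suc a)) x
raise-circWith c a x =
  ≋-trans (lin-∘ (word ∘ raiseW) (circWith c a) x) (lin-congˡ raise-circ x)
  where
  raise-circ : ∀ v → raise (circWith c a v) ≋ circWith c (suc a) v
  raise-circ []      = ≋-refl
  raise-circ (b ∷ w) =
    ++-cong {scale pone (word (suc (suc (a ℕ.+ b)) ∷ w))} (scale-word pone _)
            (≋-trans (≋-reflexive (++-identityʳ _)) (scale-word c _))

dWith-raiseW : ∀ c r → dWith c (raiseW r) ≋ raise (dWith c r)
dWith-raiseW c []      = begin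
  z 0 · one ++ []        ≡⟨ ++-identityʳ (z 0 · one) ⟩
  z 0 · one              ≈⟨ ·-one (z 0) ⟩
  z 0                    ≈⟨ ≋-sym (lin-word (word ∘ raiseW) []) ⟩
  raise one              ∎
  where open ≋-Reasoning
dWith-raiseW c (b ∷ r) = begin
  z (suc b) · X ++ lin (circWith c (suc b)) X
    ≈⟨ ++-cong (≋-sym (raise-z· b X)) (≋-sym (raise-circWith c b X)) ⟩
  raise (z b · X) ++ raise (lin (circWith c b) X)
    ≡⟨ sym (lin-++ (word ∘ raiseW) (z b · X) (lin (circWith c b) X)) ⟩
  raise (dWith c (b ∷ r)) ∎
  where
  open ≋-Reasoning
  X = dWith c r

raise-· : ∀ x y → ConstFree x → raise (x · y) ≋ raise x · y
raise-· x y x₀≗0 = begin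
  raise (x · y)                               ≈⟨ lin-congʳ (word ∘ raiseW) (·-as-lin x y) ⟩
  raise (lin (λ v → prepend v y) x)           ≈⟨ lin-∘ (word ∘ raiseW) (λ v → prepend v y) x ⟩
  lin (λ v → raise (prepend v y)) x           ≈⟨ lin-agree _ (λ v → word (raiseW v) · y) {x} raise-prepend x₀≗0 ⟩
  lin (λ v → word (raiseW v) · y) x           ≈⟨ ≋-sym (·-linˡ (word ∘ raiseW) x y) ⟩
  raise x · y                                 ∎
  where
  open ≋-Reasoning
  raise-prepend : ∀ a t → raise (prepend (a ∷ t) y) ≋ word (suc a ∷ t) · y
  raise-prepend a t = begin
    raise (prepend (a ∷ t) y)                  ≈⟨ lin-∘ (word ∘ raiseW) (λ v → word (a ∷ t ++ v)) y ⟩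
    lin (λ v → raise (word (a ∷ t ++ v))) y    ≈⟨ lin-congˡ (λ v → lin-word (word ∘ raiseW) (a ∷ t ++ v)) y ⟩
    prepend (suc a ∷ t) y                      ≈⟨ ≋-sym (word-· (suc a ∷ t) y) ⟩
    word (suc a ∷ t) · y                       ∎

coeff-raise : ∀ x u u′ → (∀ v → raiseW v ≡ u ⇔ v ≡ u′) → coeff (raise x) u ≗ coeff x u′
coeff-raise x u u′ raise⇔ n = begin
  coeff (raise x) u n                           ≡⟨ coeff-lin (word ∘ raiseW) x u n ⟩
  linSeq (λ v → coeff (word (raiseW v)) u) x n  ≡⟨ linSeq-cong match x n ⟩
  linSeq (λ v → coeff (word v) u′) x n          ≡⟨ sym (coeff-linSeq x u′ n) ⟩
  coeff x u′ n                                  ∎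
  where
  open ≡-Reasoning
  match : ∀ v k → coeff (word (raiseW v)) u k ≡ coeff (word v) u′ k
  match v k = trans (coeff-word (raiseW v) u k)
                    (trans (δ-resp {raiseW v} {u} {v} {u′} (pcoeff pone k) (to (raise⇔ v)) (from (raise⇔ v)))
                           (sym (coeff-word v u′ k)))
    where open Equivalence

coeff-raise-suc : ∀ x a t → coeff (raise x) (suc a ∷ t) ≗ coeff x (a ∷ t)
coeff-raise-suc x a t = coeff-raise x (suc a ∷ t) (a ∷ t) raise⇔
  where
  raise⇔ : ∀ v → raiseW v ≡ suc a ∷ t ⇔ v ≡ a ∷ t
  raise⇔ []      = mk⇔ (λ ()) (λ ())
  raise⇔ (b ∷ r) = mk⇔ (cong lower) (cong raiseW)
    where
    lower : Word → Word
    lower []      = []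
    lower (c ∷ s) = ℕ.pred c ∷ s

coeff-raise-z₁ : ∀ x → coeff (raise x) (0 ∷ []) ≗ coeff x []
coeff-raise-z₁ x = coeff-raise x (0 ∷ []) [] raise⇔
  where
  raise⇔ : ∀ v → raiseW v ≡ 0 ∷ [] ⇔ v ≡ []
  raise⇔ []      = mk⇔ (λ _ → refl) (λ _ → refl)
  raise⇔ (b ∷ r) = mk⇔ (λ ()) (λ ())

coeff-raise-z₁∷ : ∀ x b t → coeff (raise x) (0 ∷ b ∷ t) ≗ 0ₛ
coeff-raise-z₁∷ x b t n =
  trans (coeff-lin (word ∘ raiseW) x (0 ∷ b ∷ t) n) (linSeq-zero never x n)
  where
  never : ∀ v → coeff (word (raiseW v)) (0 ∷ b ∷ t) ≗ 0ₛ
  never []      = coeff-word-≢ {0 ∷ []} {0 ∷ b ∷ t} (λ ())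
  never (c ∷ r) = coeff-word-≢ {suc c ∷ r} {0 ∷ b ∷ t} (λ ())

T : Poly → H → H
T c x = raise x ++ (z 0 · x ++ scale c x)

T-cong : ∀ c {x y} → x ≋ y → T c x ≋ T c y
T-cong c {x} {y} x≋y =
  ++-cong (lin-congʳ (word ∘ raiseW) x≋y) (++-cong (·-congʳ (z 0) x≋y) (scale-cong {c} {c} (λ _ → refl) x≋y))

ConstFree-T : ∀ c x → ConstFree x → ConstFree (T c x)
ConstFree-T c x x₀≗0 =
  ConstFree-++ (raise x) (z 0 · x ++ scale c x) (ConstFree-raise x)
               (ConstFree-++ (z 0 · x) (scale c x) (ConstFree-z· 0 x) (ConstFree-scale c x x₀≗0))

T-· : ∀ c x y → ConstFree x → T c (x · y) ≋ T c x · y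
T-· c x y x₀≗0 = begin
  raise (x · y) ++ (z 0 · (x · y) ++ scale c (x · y))
    ≈⟨ ++-cong (raise-· x y x₀≗0) (++-cong (≋-sym (·-assoc (z 0) x y)) (≋-sym (scale-· c x y))) ⟩
  raise x · y ++ ((z 0 · x) · y ++ scale c x · y)
    ≡⟨ cong (raise x · y ++_) (sym (·-++ˡ (z 0 · x) (scale c x) y)) ⟩
  raise x · y ++ (z 0 · x ++ scale c x) · y
    ≡⟨ sym (·-++ˡ (raise x) (z 0 · x ++ scale c x) y) ⟩
  T c x · y ∎
  where open ≋-Reasoning

T-lin : ∀ c f x → T c (lin f x) ≋ lin (T c ∘ f) x
T-lin c f x = begin
  raise (lin f x) ++ (z 0 · lin f x ++ scale c (lin f x))
    ≈⟨ ++-cong (lin-∘ (word ∘ raiseW) f x) (++-cong (·-linʳ (z 0) f x) (≋-sym (lin-scaleᶠ c f x))) ⟩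
  lin (raise ∘ f) x ++ (lin (λ v → z 0 · f v) x ++ lin (λ v → scale c (f v)) x)
    ≈⟨ ++-cong {lin (raise ∘ f) x} ≋-refl (≋-sym (lin-++ᶠ (λ v → z 0 · f v) (λ v → scale c (f v)) x)) ⟩
  lin (raise ∘ f) x ++ lin (λ v → z 0 · f v ++ scale c (f v)) x
    ≈⟨ ≋-sym (lin-++ᶠ (raise ∘ f) (λ v → z 0 · f v ++ scale c (f v)) x) ⟩
  lin (T c ∘ f) x ∎
  where open ≋-Reasoning

T-scale-cancel : ∀ c x → T c x ++ neg (scale c x) ≋ T [] x
T-scale-cancel c x = begin
  (raise x ++ (z 0 · x ++ scale c x)) ++ neg (scale c x)
    ≡⟨ trans (++-assoc (raise x) (z 0 · x ++ scale c x) (neg (scale c x)))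
             (cong (raise x ++_) (++-assoc (z 0 · x) (scale c x) (neg (scale c x)))) ⟩
  raise x ++ (z 0 · x ++ (scale c x ++ neg (scale c x)))
    ≈⟨ ++-cong {raise x} ≋-refl (++-cong {z 0 · x} ≋-refl (≋-trans (++-neg (scale c x)) (≋-sym (scale-null x)))) ⟩
  T [] x ∎
  where open ≋-Reasoning

A : Poly → ℕ → H
A c zero    = z 0
A c (suc m) = T c (A c m)

ConstFree-A : ∀ c m → ConstFree (A c m)
ConstFree-A c zero    = ConstFree-word 0 []
ConstFree-A c (suc m) = ConstFree-T c (A c m) (ConstFree-A c m)

Dʷ : Poly → Word → H
Dʷ c u = φ (dWith c (φ′ u))

D : Poly → H → H
D c = lin (Dʷ c)

φ-lin-φ : ∀ c f x → (∀ w → f w ≋ dWith c w) → φ (lin f (φ x)) ≋ D c x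
φ-lin-φ c f x f≋dWith = begin
  φ (lin f (φ x))                          ≈⟨ lin-congʳ (λ v → word (phiW v)) (lin-∘ f (λ v → word (phiW v)) x) ⟩
  φ (lin (λ v → lin f (word (phiW v))) x)  ≈⟨ lin-congʳ (λ v → word (phiW v)) (lin-congˡ f-φ x) ⟩
  φ (lin (λ v → dWith c (φ′ v)) x)         ≈⟨ lin-∘ (λ v → word (phiW v)) (λ v → dWith c (φ′ v)) x ⟩
  D c x                                    ∎
  where
  open ≋-Reasoning
  f-φ : ∀ v → lin f (word (phiW v)) ≋ dWith c (φ′ v)
  f-φ v = ≋-trans (lin-word f (phiW v)) (≋-trans (f≋dWith (phiW v)) (≋-reflexive (cong (dWith c) (phiW≡φ′ v))))

φ-circWith-zero : ∀ c x → ConstFree x → φ (lin (circWith c 0) x) ≋ z 0 · φ x ++ scale c (φ x)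
φ-circWith-zero c x x₀≗0 = begin
  φ (lin (circWith c 0) x)
    ≈⟨ lin-∘ (λ v → word (phiW v)) (circWith c 0) x ⟩
  lin (λ v → φ (circWith c 0 v)) x
    ≈⟨ lin-agree _ (λ v → z 0 · word (phiW v) ++ scale c (word (phiW v))) {x} φ-circ x₀≗0 ⟩
  lin (λ v → z 0 · word (phiW v) ++ scale c (word (phiW v))) x
    ≈⟨ lin-++ᶠ (λ v → z 0 · word (phiW v)) (λ v → scale c (word (phiW v))) x ⟩
  lin (λ v → z 0 · word (phiW v)) x ++ lin (λ v → scale c (word (phiW v))) x
    ≈⟨ ++-cong (≋-sym (·-linʳ (z 0) (λ v → word (phiW v)) x)) (lin-scaleᶠ c (λ v → word (phiW v)) x) ⟩
  z 0 · φ x ++ scale c (φ x) ∎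
  where
  open ≋-Reasoning
  φ-circ : ∀ b w → φ (circWith c 0 (b ∷ w)) ≋ z 0 · word (phiW (b ∷ w)) ++ scale c (word (phiW (b ∷ w)))
  φ-circ b w = ++-cong (≋-trans (scale-one (word (phiW (suc b ∷ w))))
                                (≋-trans (≋-reflexive (cong word (phiW-suc b w))) (≋-sym (word-word (0 ∷ []) (phiW (b ∷ w))))))
                       (≋-reflexive (++-identityʳ (scale c (word (phiW (b ∷ w))))))

Dʷ-[] : ∀ c → Dʷ c [] ≋ one
Dʷ-[] c = φ-word []

Dʷ-zero : ∀ c u → Dʷ c (0 ∷ u) ≋ z 0 · Dʷ c u
Dʷ-zero c u = ≋-trans (lin-congʳ (λ v → word (phiW v)) (dWith-raiseW c (φ′ u))) (φ-raise (dWith c (φ′ u)))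

Dʷ-suc : ∀ c a u → Dʷ c (suc a ∷ u) ≋ T c (Dʷ c (a ∷ u))
Dʷ-suc c a u = begin
  φ (z 0 · X ++ lin (circWith c 0) X)           ≡⟨ lin-++ (λ v → word (phiW v)) (z 0 · X) (lin (circWith c 0) X) ⟩
  φ (z 0 · X) ++ φ (lin (circWith c 0) X)       ≈⟨ ++-cong (φ-z0· X) (φ-circWith-zero c X X₀≗0) ⟩
  T c (φ X)                                     ∎
  where
  open ≋-Reasoning
  X = dWith c (φ′-∷ a u)
  X₀≗0 : ConstFree X
  X₀≗0 = ConstFree-dWith c (φ′-∷ a u) (φ′-∷-≢[] a u)

Dʷ-∷ : ∀ c a u → Dʷ c (a ∷ u) ≋ A c a · Dʷ c u
Dʷ-∷ c zero    u = Dʷ-zero c u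
Dʷ-∷ c (suc a) u = begin
  Dʷ c (suc a ∷ u)              ≈⟨ Dʷ-suc c a u ⟩
  T c (Dʷ c (a ∷ u))            ≈⟨ T-cong c (Dʷ-∷ c a u) ⟩
  T c (A c a · Dʷ c u)          ≈⟨ T-· c (A c a) (Dʷ c u) (ConstFree-A c a) ⟩
  A c (suc a) · Dʷ c u          ∎
  where open ≋-Reasoning

Dʷ-++ : ∀ c u v → Dʷ c (u ++ v) ≋ Dʷ c u · Dʷ c v
Dʷ-++ c []      v = ≋-sym (≋-trans (·-congˡ (Dʷ c v) (Dʷ-[] c)) (one-· (Dʷ c v)))
Dʷ-++ c (a ∷ u) v = begin
  Dʷ c (a ∷ u ++ v)               ≈⟨ Dʷ-∷ c a (u ++ v) ⟩
  A c a · Dʷ c (u ++ v)           ≈⟨ ·-congʳ (A c a) (Dʷ-++ c u v) ⟩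
  A c a · (Dʷ c u · Dʷ c v)       ≈⟨ ≋-sym (·-assoc (A c a) (Dʷ c u) (Dʷ c v)) ⟩
  (A c a · Dʷ c u) · Dʷ c v       ≈⟨ ·-congˡ (Dʷ c v) (≋-sym (Dʷ-∷ c a u)) ⟩
  Dʷ c (a ∷ u) · Dʷ c v           ∎
  where open ≋-Reasoning

lin-multiplicative : ∀ F → (∀ u v → F (u ++ v) ≋ F u · F v) → ∀ x y → lin F (x · y) ≋ lin F x · lin F y
lin-multiplicative F F-++ x y = begin
  lin F (x · y)                            ≈⟨ lin-congʳ F (·-as-lin x y) ⟩
  lin F (lin (λ v → prepend v y) x)        ≈⟨ lin-∘ F (λ v → prepend v y) x ⟩
  lin (λ v → lin F (prepend v y)) x        ≈⟨ lin-congˡ F-prepend x ⟩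
  lin (λ v → F v · lin F y) x              ≈⟨ ≋-sym (·-linˡ F x (lin F y)) ⟩
  lin F x · lin F y                        ∎
  where
  open ≋-Reasoning
  F-prepend : ∀ v → lin F (prepend v y) ≋ F v · lin F y
  F-prepend v = begin
    lin F (prepend v y)                  ≈⟨ lin-∘ F (λ v′ → word (v ++ v′)) y ⟩
    lin (λ v′ → lin F (word (v ++ v′))) y ≈⟨ lin-congˡ (λ v′ → ≋-trans (lin-word F (v ++ v′)) (F-++ v v′)) y ⟩
    lin (λ v′ → F v · F v′) y            ≈⟨ ≋-sym (·-linʳ (F v) F y) ⟩
    F v · lin F y                        ∎

D-· : ∀ c x y → D c (x · y) ≋ D c x · D c y
D-· c = lin-multiplicative (Dʷ c) (Dʷ-++ c)

D-z : ∀ c a → D c (z a) ≋ A c a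
D-z c a = begin
  D c (z a)                  ≈⟨ lin-word (Dʷ c) (a ∷ []) ⟩
  Dʷ c (a ∷ [])              ≈⟨ Dʷ-∷ c a [] ⟩
  A c a · Dʷ c []            ≈⟨ ·-congʳ (A c a) (Dʷ-[] c) ⟩
  A c a · one                ≈⟨ ·-one (A c a) ⟩
  A c a                      ∎
  where open ≋-Reasoning

D-raise : ∀ c x → ConstFree x → D c (raise x) ≋ T c (D c x)
D-raise c x x₀≗0 = begin
  D c (raise x)                          ≈⟨ lin-∘ (Dʷ c) (word ∘ raiseW) x ⟩
  lin (λ v → D c (word (raiseW v))) x    ≈⟨ lin-agree _ (T c ∘ Dʷ c) {x} D-raise-word x₀≗0 ⟩
  lin (T c ∘ Dʷ c) x                     ≈⟨ ≋-sym (T-lin c (Dʷ c) x) ⟩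
  T c (D c x)                            ∎
  where
  open ≋-Reasoning
  D-raise-word : ∀ a t → D c (word (suc a ∷ t)) ≋ T c (Dʷ c (a ∷ t))
  D-raise-word a t = ≋-trans (lin-word (Dʷ c) (suc a ∷ t)) (Dʷ-suc c a t)

φ-d-φ : ∀ x → φ (d (φ x)) ≋ D [] x
φ-d-φ x = φ-lin-φ [] dW x dW≋dWith

φ-dq-φ : ∀ x → φ (dq (φ x)) ≋ D ħ x
φ-dq-φ x = φ-lin-φ ħ dqW x (≋-reflexive ∘ dqW≡dWith)

-- The elements ξ_i

ι : ℕ → ℚ
ι k = ℤ.+ k / 1

ι-+ : ∀ a b → ι a + ι b ≡ ι (a ℕ.+ b)
ι-+ a b = trans (cong₂ _+_ (ι≡mkℚ a) (ι≡mkℚ b))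
                (ℚₚ./-cong {ℤ.+ a ℤ.* ℤ.+ 1 ℤ.+ ℤ.+ b ℤ.* ℤ.+ 1} {1} {ℤ.+ (a ℕ.+ b)} {1} numerator refl)
  where
  ι≡mkℚ : ∀ a → ι a ≡ mkℚ (ℤ.+ a) 0 (Coprime.sym (1-coprimeTo a))
  ι≡mkℚ a = ℚₚ.normalize-coprime (Coprime.sym (1-coprimeTo a))
  numerator : ℤ.+ a ℤ.* ℤ.+ 1 ℤ.+ ℤ.+ b ℤ.* ℤ.+ 1 ≡ ℤ.+ (a ℕ.+ b)
  numerator = cong₂ ℤ._+_ (ℤₚ.*-identityʳ (ℤ.+ a)) (ℤₚ.*-identityʳ (ℤ.+ b))

ξcoeff : ℕ → ℕ → Seq
ξcoeff m k = pcoeff (monomial (negOnePow (m ∸ k) * ι (m C k)) (m ∸ k))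

ξcoeff-beyond : ∀ m k → m < k → ξcoeff m k ≗ 0ₛ
ξcoeff-beyond m k m<k n = begin
  pcoeff (monomial (negOnePow (m ∸ k) * ι (m C k)) (m ∸ k)) n
    ≡⟨ cong₂ (λ e c → pcoeff (monomial (negOnePow e * ι c) e) n) (ℕₚ.m≤n⇒m∸n≡0 (ℕₚ.<⇒≤ m<k)) (k>n⇒nCk≡0 m<k) ⟩
  pcoeff (monomial 0ℚ 0) n
    ≡⟨ monomial-zero 0 n ⟩
  0ℚ ∎
  where open ≡-Reasoning

ξcoeff-suc-zero : ∀ m n → ξcoeff (suc m) 0 n ≡ - (pcoeff ħ ⋆ ξcoeff m 0) n
ξcoeff-suc-zero m n = begin
  pcoeff (monomial (- negOnePow m * ι 1) (suc m)) n
    ≡⟨ cong (λ c → pcoeff (monomial c (suc m)) n) (sym (ℚₚ.neg-distribˡ-* (negOnePow m) (ι 1))) ⟩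
  pcoeff (monomial (- (negOnePow m * ι 1)) (suc m)) n
    ≡⟨ monomial-neg (negOnePow m * ι 1) (suc m) n ⟩
  - pcoeff (monomial (negOnePow m * ι 1) (suc m)) n
    ≡⟨ cong -_ (sym (ħ⋆monomial (negOnePow m * ι 1) m n)) ⟩
  - (pcoeff ħ ⋆ ξcoeff m 0) n ∎
  where open ≡-Reasoning

ξcoeff-pascal : ∀ m j n → ξcoeff (suc m) (suc j) n ≡ ξcoeff m j n + - (pcoeff ħ ⋆ ξcoeff m (suc j)) n
ξcoeff-pascal m j n with ℕₚ.<-cmp j m
... | tri< j<m _ _ = interior (m ∸ j) (m ∸ suc j) (ℕₚ.+-∸-assoc 1 j<m)
  where
  open ≡-Reasoning
  open +-*-Solver using (solve; _:+_; _:*_; :-_; _:=_)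
  pascal : ι (suc m C suc j) ≡ ι (m C j) + ι (m C suc j)
  pascal = sym (trans (ι-+ (m C j) (m C suc j)) (cong ι (nCk+nC[k+1]≡[n+1]C[k+1] m j)))
  distrib : ∀ s a b → - s * (a + b) ≡ - s * a + - (s * b)
  distrib = solve 3 (λ s a b → (:- s) :* (a :+ b) := (:- s) :* a :+ :- (s :* b)) refl
  interior : ∀ d e → d ≡ suc e →
             pcoeff (monomial (negOnePow d * ι (suc m C suc j)) d) n ≡
             pcoeff (monomial (negOnePow d * ι (m C j)) d) n + - (pcoeff ħ ⋆ pcoeff (monomial (negOnePow e * ι (m C suc j)) e)) n
  interior .(suc e) e refl = begin
    pcoeff (monomial (- s * ι (suc m C suc j)) (suc e)) n
      ≡⟨ cong (λ c → pcoeff (monomial c (suc e)) n) (trans (cong (- s *_) pascal) (distrib s (ι (m C j)) (ι (m C suc j)))) ⟩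
    pcoeff (monomial (- s * ι (m C j) + - (s * ι (m C suc j))) (suc e)) n
      ≡⟨ monomial-+ (- s * ι (m C j)) (- (s * ι (m C suc j))) (suc e) n ⟩
    pcoeff (monomial (- s * ι (m C j)) (suc e)) n + pcoeff (monomial (- (s * ι (m C suc j))) (suc e)) n
      ≡⟨ cong (pcoeff (monomial (- s * ι (m C j)) (suc e)) n +_)
              (trans (monomial-neg (s * ι (m C suc j)) (suc e) n) (cong -_ (sym (ħ⋆monomial (s * ι (m C suc j)) e n)))) ⟩
    pcoeff (monomial (- s * ι (m C j)) (suc e)) n + - (pcoeff ħ ⋆ pcoeff (monomial (s * ι (m C suc j)) e)) n ∎
    where s = negOnePow e
... | tri≈ _ refl _ = begin
  ξcoeff (suc j) (suc j) n
    ≡⟨ cong (λ c → pcoeff (monomial (negOnePow (j ∸ j) * ι c) (j ∸ j)) n) (trans (nCn≡1 (suc j)) (sym (nCn≡1 j))) ⟩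
  ξcoeff j j n
    ≡⟨ sym (ℚₚ.+-identityʳ (ξcoeff j j n)) ⟩
  ξcoeff j j n + - 0ℚ
    ≡⟨ cong (λ t → ξcoeff j j n + - t) (sym (⋆-zeroʳ (pcoeff ħ) (ξcoeff-beyond j (suc j) (ℕₚ.n<1+n j)) n)) ⟩
  ξcoeff j j n + - (pcoeff ħ ⋆ ξcoeff j (suc j)) n ∎
  where open ≡-Reasoning
... | tri> _ _ m<j = begin
  ξcoeff (suc m) (suc j) n
    ≡⟨ ξcoeff-beyond (suc m) (suc j) (s≤s m<j) n ⟩
  0ℚ + - 0ℚ
    ≡⟨ sym (cong₂ (λ a b → a + - b) (ξcoeff-beyond m j m<j n)
                  (⋆-zeroʳ (pcoeff ħ) (ξcoeff-beyond m (suc j) (ℕₚ.m<n⇒m<1+n m<j)) n)) ⟩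
  ξcoeff m j n + - (pcoeff ħ ⋆ ξcoeff m (suc j)) n ∎
  where open ≡-Reasoning

letters : (ℕ → Poly) → List ℕ → H
letters P = map (λ k → (P k , k ∷ []))

letters-upTo-suc : ∀ P N → letters P (upTo (suc N)) ≡ letters P (upTo N) ++ (P N , N ∷ []) ∷ []
letters-upTo-suc P N = trans (cong (letters P) (sym (upTo-∷ʳ N))) (map-++ _ (upTo N) (N ∷ []))

coeff-letters-upTo-suc : ∀ P N j n →
  coeff (letters P (upTo (suc N))) (j ∷ []) n ≡
  coeff (letters P (upTo N)) (j ∷ []) n + δ (N ∷ []) (j ∷ []) (pcoeff (P N) n)
coeff-letters-upTo-suc P N j n =
  trans (cong (λ x → coeff x (j ∷ []) n) (letters-upTo-suc P N))
        (trans (coeff-++ (letters P (upTo N)) ((P N , N ∷ []) ∷ []) (j ∷ []) n)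
               (cong (coeff (letters P (upTo N)) (j ∷ []) n +_) last))
  where
  last : coeff ((P N , N ∷ []) ∷ []) (j ∷ []) n ≡ δ (N ∷ []) (j ∷ []) (pcoeff (P N) n)
  last = trans (coeff-∷ (P N) (N ∷ []) [] (j ∷ []) n) (ℚₚ.+-identityʳ (δ (N ∷ []) (j ∷ []) (pcoeff (P N) n)))

mutual
  coeff-letters-beyond : ∀ P N j → N ≤ j → coeff (letters P (upTo N)) (j ∷ []) ≗ 0ₛ
  coeff-letters-beyond P zero    j N≤j n = refl
  coeff-letters-beyond P (suc N) j N<j n =
    trans (coeff-letters-upTo-suc P N j n)
          (trans (cong₂ _+_ (coeff-letters-beyond P N j (ℕₚ.<⇒≤ N<j) n)
                            (δ-≢ {N ∷ []} {j ∷ []} (pcoeff (P N) n) (ℕₚ.<⇒≢ N<j ∘ ∷-injectiveˡ)))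
                 (ℚₚ.+-identityʳ 0ℚ))

  coeff-letters-within : ∀ P N j → j < N → coeff (letters P (upTo N)) (j ∷ []) ≗ pcoeff (P j)
  coeff-letters-within P (suc N) j j<1+N n with ℕₚ.m≤n⇒m<n∨m≡n (ℕₚ.≤-pred j<1+N)
  ... | inj₁ j<N  =
    trans (coeff-letters-upTo-suc P N j n)
          (trans (cong₂ _+_ (coeff-letters-within P N j j<N n)
                            (δ-≢ {N ∷ []} {j ∷ []} (pcoeff (P N) n) (ℕₚ.<⇒≢ j<N ∘ sym ∘ ∷-injectiveˡ)))
                 (ℚₚ.+-identityʳ (pcoeff (P j) n)))
  ... | inj₂ refl =
    trans (coeff-letters-upTo-suc P N N n)
          (trans (cong₂ _+_ (coeff-letters-beyond P N N ℕₚ.≤-refl n) (δ-refl (N ∷ []) (pcoeff (P N) n)))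
                 (ℚₚ.+-identityˡ (pcoeff (P N) n)))

coeff-letters-nonletter : ∀ P L u → (∀ j → u ≢ j ∷ []) → coeff (letters P L) u ≗ 0ₛ
coeff-letters-nonletter P []      u nonletter n = refl
coeff-letters-nonletter P (k ∷ L) u nonletter n =
  trans (coeff-∷ (P k) (k ∷ []) (letters P L) u n)
        (trans (cong₂ _+_ (δ-≢ {k ∷ []} {u} (pcoeff (P k) n) (nonletter k ∘ sym)) (coeff-letters-nonletter P L u nonletter n))
               (ℚₚ.+-identityʳ 0ℚ))

ξ-letter : ∀ m j → coeff (ξ (suc m)) (j ∷ []) ≗ ξcoeff m j
ξ-letter m j with j ℕ.<? suc m
... | yes j≤m = coeff-letters-within (λ k → monomial (negOnePow (m ∸ k) * ι (m C k)) (m ∸ k)) (suc m) j j≤m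
... | no  j≰m = λ n →
  trans (coeff-letters-beyond (λ k → monomial (negOnePow (m ∸ k) * ι (m C k)) (m ∸ k)) (suc m) j (ℕₚ.≮⇒≥ j≰m) n)
        (sym (ξcoeff-beyond m j (ℕₚ.≮⇒≥ j≰m) n))

ξ-nonletter : ∀ m u → (∀ j → u ≢ j ∷ []) → coeff (ξ (suc m)) u ≗ 0ₛ
ξ-nonletter m = coeff-letters-nonletter (λ k → monomial (negOnePow (m ∸ k) * ι (m C k)) (m ∸ k)) (upTo (suc m))

ConstFree-ξ : ∀ m → ConstFree (ξ (suc m))
ConstFree-ξ m = ξ-nonletter m [] (λ j ())

ξ-recursion : ∀ m → ξ (suc (suc m)) ≋ raise (ξ (suc m)) ++ neg (scale ħ (ξ (suc m)))
ξ-recursion m = mk≋ λ u n → trans (pointwise u n) (sym (rhs u n))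
  where
  X = ξ (suc m)
  RHS : Word → Seq
  RHS u n = coeff (raise X) u n + - (pcoeff ħ ⋆ coeff X u) n
  rhs : ∀ u n → coeff (raise X ++ neg (scale ħ X)) u n ≡ RHS u n
  rhs u n = trans (coeff-++ (raise X) (neg (scale ħ X)) u n)
                  (cong (coeff (raise X) u n +_) (trans (coeff-neg (scale ħ X) u n) (cong -_ (coeff-scale ħ X u n))))
  RHS-resp : ∀ u {r s} → coeff (raise X) u ≗ r → coeff X u ≗ s → ∀ n → RHS u n ≡ r n + - (pcoeff ħ ⋆ s) n
  RHS-resp u r≗ s≗ n = cong₂ (λ a b → a + - b) (r≗ n) (⋆-cong (λ _ → refl) s≗ n)
  vanishing : ∀ u → (∀ j → u ≢ j ∷ []) → coeff (raise X) u ≗ 0ₛ → ∀ n → coeff (ξ (suc (suc m))) u n ≡ RHS u n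
  vanishing u nonletter raise≗0 n = begin
    coeff (ξ (suc (suc m))) u n      ≡⟨ ξ-nonletter (suc m) u nonletter n ⟩
    0ℚ + - 0ℚ                        ≡⟨ cong (λ b → 0ℚ + - b) (sym (⋆-zeroʳ (pcoeff ħ) (λ _ → refl) n)) ⟩
    0ℚ + - (pcoeff ħ ⋆ 0ₛ) n         ≡⟨ sym (RHS-resp u raise≗0 (ξ-nonletter m u nonletter) n) ⟩
    RHS u n                          ∎
    where open ≡-Reasoning
  pointwise : ∀ u n → coeff (ξ (suc (suc m))) u n ≡ RHS u n
  pointwise []              = vanishing [] (λ j ()) (ConstFree-raise X)
  pointwise (0 ∷ b ∷ t)     = vanishing (0 ∷ b ∷ t) (λ j ()) (coeff-raise-z₁∷ X b t)
  pointwise (suc a ∷ b ∷ t) = vanishing (suc a ∷ b ∷ t) (λ j ()) raise≗0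
    where
    raise≗0 : coeff (raise X) (suc a ∷ b ∷ t) ≗ 0ₛ
    raise≗0 k = trans (coeff-raise-suc X a (b ∷ t) k) (ξ-nonletter m (a ∷ b ∷ t) (λ j ()) k)
  pointwise (0 ∷ [])        n = begin
    coeff (ξ (suc (suc m))) (0 ∷ []) n   ≡⟨ ξ-letter (suc m) 0 n ⟩
    ξcoeff (suc m) 0 n                   ≡⟨ ξcoeff-suc-zero m n ⟩
    - (pcoeff ħ ⋆ ξcoeff m 0) n          ≡⟨ sym (ℚₚ.+-identityˡ _) ⟩
    0ℚ + - (pcoeff ħ ⋆ ξcoeff m 0) n     ≡⟨ sym (RHS-resp (0 ∷ []) raise≗0 (ξ-letter m 0) n) ⟩
    RHS (0 ∷ []) n                       ∎
    where
    open ≡-Reasoning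
    raise≗0 : coeff (raise X) (0 ∷ []) ≗ 0ₛ
    raise≗0 k = trans (coeff-raise-z₁ X k) (ConstFree-ξ m k)
  pointwise (suc j ∷ [])    n = begin
    coeff (ξ (suc (suc m))) (suc j ∷ []) n             ≡⟨ ξ-letter (suc m) (suc j) n ⟩
    ξcoeff (suc m) (suc j) n                           ≡⟨ ξcoeff-pascal m j n ⟩
    ξcoeff m j n + - (pcoeff ħ ⋆ ξcoeff m (suc j)) n   ≡⟨ sym (RHS-resp (suc j ∷ []) raise≗ (ξ-letter m (suc j)) n) ⟩
    RHS (suc j ∷ []) n                                 ∎
    where
    open ≡-Reasoning
    raise≗ : coeff (raise X) (suc j ∷ []) ≗ ξcoeff m j
    raise≗ k = trans (coeff-raise-suc X j [] k) (ξ-letter m j k)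

ξ-one : ξ 1 ≋ z 0
ξ-one = begin
  (q , 0 ∷ []) ∷ []     ≈⟨ ≋-sym (scale-word q (0 ∷ [])) ⟩
  scale q (z 0)         ≈⟨ scale-cong {q} {pone} {z 0} (λ { zero → refl ; (suc n) → refl }) ≋-refl ⟩
  scale pone (z 0)      ≈⟨ scale-one (z 0) ⟩
  z 0                   ∎
  where
  open ≋-Reasoning
  q = monomial (negOnePow 0 * ι (0 C 0)) 0

D-neg-scale : ∀ c p x → D c (neg (scale p x)) ≋ neg (scale p (D c x))
D-neg-scale c p x = ≋-trans (lin-scale (Dʷ c) (- 1ℚ ∷ []) (scale p x))
                            (scale-cong {(- 1ℚ ∷ [])} (λ _ → refl) (lin-scale (Dʷ c) p x))

D-ξ : ∀ m → D ħ (ξ (suc m)) ≋ A [] m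
D-ξ zero    = ≋-trans (lin-congʳ (Dʷ ħ) ξ-one) (D-z ħ 0)
D-ξ (suc m) = begin
  D ħ (ξ (suc (suc m)))
    ≈⟨ lin-congʳ (Dʷ ħ) (ξ-recursion m) ⟩
  D ħ (raise X ++ neg (scale ħ X))
    ≡⟨ lin-++ (Dʷ ħ) (raise X) (neg (scale ħ X)) ⟩
  D ħ (raise X) ++ D ħ (neg (scale ħ X))
    ≈⟨ ++-cong (D-raise ħ X (ConstFree-ξ m)) (D-neg-scale ħ ħ X) ⟩
  T ħ (D ħ X) ++ neg (scale ħ (D ħ X))
    ≈⟨ ++-cong (T-cong ħ (D-ξ m)) (scale-cong {(- 1ℚ ∷ [])} (λ _ → refl) (scale-cong {ħ} (λ _ → refl) (D-ξ m))) ⟩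
  T ħ (A [] m) ++ neg (scale ħ (A [] m))
    ≈⟨ T-scale-cancel ħ (A [] m) ⟩
  A [] (suc m) ∎
  where
  open ≋-Reasoning
  X = ξ (suc m)

D-injective : ∀ x y → D ħ x ≋ D ħ y → x ≋ y
D-injective x y Dx≋Dy = φ-cancel (dq-injective (φ-cancel (≋-trans (φ-dq-φ x) (≋-trans Dx≋Dy (≋-sym (φ-dq-φ y))))))

D-φ-preimage : ∀ v x → dq v ≈ d (φ x) → D ħ (φ v) ≋ D [] x
D-φ-preimage v x dqv≈ = begin
  D ħ (φ v)             ≈⟨ ≋-sym (φ-dq-φ (φ v)) ⟩
  φ (dq (φ (φ v)))      ≈⟨ φ-cong (lin-congʳ dqW (φ-involutive v)) ⟩
  φ (dq v)              ≈⟨ φ-cong (mk≋ {dq v} {d (φ x)} dqv≈) ⟩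
  φ (d (φ x))           ≈⟨ φ-d-φ x ⟩
  D [] x                ∎
  where open ≋-Reasoning

proposition4p4 : ∀ (i : ℕ) → 1 ≤ i → ∀ (w v v′ : H) →
    dq v ≈ d (φ (z (i Data.Nat.∸ 1) · w)) →
    dq v′ ≈ d (φ w) →
    φ v ≈ ξ i · φ v′
proposition4p4 (suc m) _ w v v′ dq-v dq-v′ = coeff-≡ (D-injective (φ v) (ξ (suc m) · φ v′) (begin
  D ħ (φ v)                      ≈⟨ D-φ-preimage v (z m · w) dq-v ⟩
  D [] (z m · w)                 ≈⟨ D-· [] (z m) w ⟩
  D [] (z m) · D [] w            ≈⟨ ·-congˡ (D [] w) (D-z [] m) ⟩
  A [] m · D [] w                ≈⟨ ≋-sym (·-cong (D-ξ m) (D-φ-preimage v′ w dq-v′)) ⟩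
  D ħ (ξ (suc m)) · D ħ (φ v′)   ≈⟨ ≋-sym (D-· ħ (ξ (suc m)) (φ v′)) ⟩
  D ħ (ξ (suc m) · φ v′)         ∎))
  where open ≋-Reasoning
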